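{- Let $G(A,B)$ be a cubic bipartite graph with bipartition $(A,B)$ and let $\partial(X)=\{uv,wz\}$ be a 2-cut of $G$ with $u,w\in X$ and $uw\notin E(G)$. Let $a\in A$, $b\in B$. Then: (i) if $(a,b)$ is a nice pair of $G$, then either $\{a,b\}\subseteq X$ or $\{a,b\}\subseteq\overline{X}$; (ii) if $\{a,b\}\subseteq X$, then $(a,b)$ is a nice pair of $G$ if and only if it is a nice pair of $G[X]+uw$.
   Context: All graphs are finite, simple and connected. For $\emptyset\ne X\subsetneq V(G)$, $\partial(X)$ is the set of edges with exactly one end in $X$, $\overline X=V(G)\setminus X$; a 2-cut is an edge cut with 2 edges. In a bipartite graph $H$ with colour classes containing $a$ and $b$ respectively, $(a,b)$ is a nice pair if $H-(N_H[a]\cup N_H[b])$ has a perfect matching. -}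

module Defs where

open import Data.Nat using (ℕ; zero; suc)
open import Data.Fin using (Fin; _≟_)
open import Data.Bool using (Bool; true; false; _∧_; _∨_; if_then_else_; not)
open import Data.List using (List; map; allFin)
open import Data.Nat.ListAction using (sum)
open import Data.Sum using (_⊎_)
open import Data.Product using (Σ; _×_; _,_; ∃)
open import Relation.Binary.PropositionalEquality using (_≡_; _≢_)
open import Relation.Nullary using (¬_)
open import Relation.Nullary.Decidable using (⌊_⌋)

record Graph : Set where
  field
    n      : ℕ
    adj    : Fin n → Fin n → Bool
    sym    : ∀ x y → adj x y ≡ adj y x
    irrefl : ∀ x → adj x x ≡ false
open Graph public

data Reach (G : Graph) : Fin (n G) → Fin (n G) → Set where
  here : ∀ {x} → Reach G x x
  step : ∀ {x y z} → adj G x y ≡ true → Reach G y z → Reach G x z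

Connected : Graph → Set
Connected G = ∀ x y → Reach G x y

deg : (G : Graph) → Fin (n G) → ℕ
deg G x = sum (map (λ y → if adj G x y then 1 else 0) (allFin (n G)))

Cubic : Graph → Set
Cubic G = ∀ x → deg G x ≡ 3

-- (A , B) is a bipartition given by col : A = col⁻¹(false), B = col⁻¹(true);
-- every edge joins the two classes.
IsBipartition : (G : Graph) → (Fin (n G) → Bool) → Set
IsBipartition G col = ∀ x y → adj G x y ≡ true → col x ≢ col y

-- Perfect matching of the subgraph induced (w.r.t. adjacency E) on the vertex
-- set R, given as a fixed-point-free involution pairing each vertex of R with
-- an E-neighbour in R.
HasPerfectMatching : {m : ℕ} → (E : Fin m → Fin m → Bool) → (R : Fin m → Bool) → Set
HasPerfectMatching {m} E R =
  Σ (Fin m → Fin m) λ μ →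
    ∀ x → R x ≡ true →
      (R (μ x) ≡ true) × (μ x ≢ x) × (μ (μ x) ≡ x) × (E x (μ x) ≡ true)

-- H is the graph with vertex set S and adjacency E (restricted to S).
-- (a , b) nice pair of H : H - (N_H[a] ∪ N_H[b]) has a perfect matching.
remaining : {m : ℕ} → (E : Fin m → Fin m → Bool) → (S : Fin m → Bool) →
            Fin m → Fin m → Fin m → Bool
remaining E S a b x =
  S x ∧ not ⌊ x ≟ a ⌋ ∧ not ⌊ x ≟ b ⌋ ∧ not (E x a) ∧ not (E x b)

NicePairIn : {m : ℕ} → (E : Fin m → Fin m → Bool) → (S : Fin m → Bool) →
             Fin m → Fin m → Set
NicePairIn E S a b = HasPerfectMatching E (remaining E S a b)

NicePair : (G : Graph) → Fin (n G) → Fin (n G) → Set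
NicePair G = NicePairIn (adj G) (λ _ → true)

adjPlus : (G : Graph) → Fin (n G) → Fin (n G) → Fin (n G) → Fin (n G) → Bool
adjPlus G u w x y =
  adj G x y ∨ (⌊ x ≟ u ⌋ ∧ ⌊ y ≟ w ⌋) ∨ (⌊ x ≟ w ⌋ ∧ ⌊ y ≟ u ⌋)

NicePairSubPlus : (G : Graph) → (X : Fin (n G) → Bool) → Fin (n G) → Fin (n G) →
                  Fin (n G) → Fin (n G) → Set
NicePairSubPlus G X u w = NicePairIn (adjPlus G u w) X

IsTwoCut : (G : Graph) → (X : Fin (n G) → Bool) →
           (u v w z : Fin (n G)) → Set
IsTwoCut G X u v w z =
  (∃ λ x → X x ≡ true) × (∃ λ x → X x ≡ false) ×
  X u ≡ true × X w ≡ true × X v ≡ false × X z ≡ false ×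
  adj G u v ≡ true × adj G w z ≡ true ×
  ¬ (u ≡ w × v ≡ z) ×
  (∀ x y → adj G x y ≡ true → X x ≡ true → X y ≡ false →
     (x ≡ u × y ≡ v) ⊎ (x ≡ w × y ≡ z))

-- In a cubic bipartite graph with colour classes A and B, counting edge ends in a vertex set X
-- gives 3|X ∩ A| − 3|X ∩ B| = (cut edges with their X-end in A) − (cut edges with their X-end in B).
-- For a 2-cut this forces the inner ends u, w to have different colours and X, as well as its
-- complement, to be balanced.  A perfect matching of any vertex set pairs A- with B-vertices, so a
-- balanced set has as many A- as B-vertices that are not matched inside it.
--
-- (i) If a ∈ X ∩ A and b ∉ X, a perfect matching of G − N[a] − N[b] leaves unmatched inside X every
-- neighbour of a in X, that is 3 − [a = u] B-vertices, but no A-vertex other than a and u.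
-- (ii) The same count on the complement of X shows that a perfect matching of G − N[a] − N[b]
-- matches u to v exactly when it matches w to z, unless a or b blocks one of these edges; so its
-- restriction to X, with uw added where needed, is a perfect matching of G[X] + uw − N[a] − N[b].
-- Conversely, such a matching is completed outside X by a perfect matching of G through uv or
-- avoiding uv, which by the count on X uses wz exactly when it uses uv.  Both exist by König's
-- theorem (a regular bipartite graph has a perfect matching), applied to G and to G minus a
-- perfect matching.

module Submission where

open import Data.Bool using (Bool; true; false; _∧_; _∨_; not; if_then_else_)
import Data.Bool as Bool
open import Data.Bool.Properties
  using (∧-assoc; ∧-identityʳ; ∧-zeroʳ; ∧-conicalˡ; ∧-conicalʳ; ∨-comm; ∨-idem; ∨-zeroʳ; ∨-conicalˡ; ∨-conicalʳ
        ; ¬-not)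
open import Data.Empty using (⊥; ⊥-elim)
open import Data.Fin using (Fin; zero; suc; _≟_)
open import Data.Fin.Properties using (any?)
import Data.Fin.Properties as Fin
open import Data.List using (tabulate)
open import Data.List.Properties using (map-tabulate)
open import Data.Nat using (ℕ; zero; suc; _+_; _*_; _≤_; _<_; z≤n; s≤s)
open import Data.Nat.DivMod using (_%_; m*n%n≡0; [m+kn]%n≡m%n)
open import Data.Nat.ListAction using () renaming (sum to listSum)
open import Data.Nat.Properties hiding (_≟_)
open import Algebra.Properties.Semiring.Sum +-*-semiring
  using (sum; sum-syntax; ∑-distrib-+; ∑-comm; sum-cong-≗; *-distribʳ-sum)
open import Data.Product using (_×_; _,_; ∃; proj₁; proj₂)
open import Data.Sum using (_⊎_; inj₁; inj₂; [_,_]′)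
open import Data.Vec.Functional using (Vector)
open import Function using (_∘_; id)
open import Function.Bundles using (_⇔_; mk⇔; Equivalence)
open import Relation.Binary.PropositionalEquality
open import Relation.Nullary using (¬_; yes; no; Dec)
open import Relation.Nullary.Decidable using (⌊_⌋; _×-dec_; _⊎-dec_)
open import Defs hiding (sym)

-- Vertex sets and counting

true≢false : true ≢ false
true≢false ()

module _ {m : ℕ} where

  infix 4 _∈_ _∉_ _⊆_ _≡?_
  infixr 7 _∩_
  infixr 6 _∪_

  _∈_ _∉_ : Fin m → (Fin m → Bool) → Set
  x ∈ S = S x ≡ true
  x ∉ S = S x ≡ false

  _⊆_ : (Fin m → Bool) → (Fin m → Bool) → Set
  S ⊆ T = ∀ {x} → x ∈ S → x ∈ T

  ⁅_⁆ : Fin m → Fin m → Bool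
  ⁅ c ⁆ x = ⌊ x ≟ c ⌋

  ∁ : (Fin m → Bool) → Fin m → Bool
  ∁ S x = not (S x)

  _∩_ _∪_ : (Fin m → Bool) → (Fin m → Bool) → Fin m → Bool
  (S ∩ T) x = S x ∧ T x
  (S ∪ T) x = S x ∨ T x

  -- Used instead of x ≟ y so that case splits do not abstract the ⌊ x ≟ c ⌋ tests inside link and unlink.
  _≡?_ : (x y : Fin m) → x ≡ y ⊎ x ≢ y
  x ≡? y with x ≟ y
  ... | yes x≡y = inj₁ x≡y
  ... | no x≢y  = inj₂ x≢y

  ∈-⁅⁆ : ∀ c → c ∈ ⁅ c ⁆
  ∈-⁅⁆ c with c ≟ c
  ... | yes _ = refl
  ... | no c≢c = ⊥-elim (c≢c refl)

  ∉-⁅⁆ : ∀ {c x} → x ≢ c → x ∉ ⁅ c ⁆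
  ∉-⁅⁆ {c} {x} x≢c with x ≟ c
  ... | yes x≡c = ⊥-elim (x≢c x≡c)
  ... | no _ = refl

  ≡⇒∈-⁅⁆ : ∀ {c x} → x ≡ c → x ∈ ⁅ c ⁆
  ≡⇒∈-⁅⁆ refl = ∈-⁅⁆ _

  ∈-⁅⁆⁻ : ∀ {c x} → x ∈ ⁅ c ⁆ → x ≡ c
  ∈-⁅⁆⁻ {c} {x} h with x ≟ c
  ... | yes x≡c = x≡c
  ∈-⁅⁆⁻ () | no _

  ∉-⁅⁆⁻ : ∀ {c x} → x ∉ ⁅ c ⁆ → x ≢ c
  ∉-⁅⁆⁻ {c} x∉⁅c⁆ refl = true≢false (trans (sym (∈-⁅⁆ c)) x∉⁅c⁆)

  ∈∉⇒≢ : ∀ {S x y} → x ∈ S → y ∉ S → x ≢ y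
  ∈∉⇒≢ {S} x∈S y∉S refl with () ← trans (sym x∈S) y∉S

  ∈-∁ : ∀ S {x} → x ∉ S → x ∈ ∁ S
  ∈-∁ S = cong not

  ∈-∁⁻ : ∀ S {x} → x ∈ ∁ S → x ∉ S
  ∈-∁⁻ S {x} h with S x
  ... | false = refl

  ∉-∁⁻ : ∀ S {x} → x ∉ ∁ S → x ∈ S
  ∉-∁⁻ S {x} h with S x
  ... | true = refl

  ∉-∪ : ∀ S T {x} → x ∉ S → x ∉ T → x ∉ S ∪ T
  ∉-∪ S T = cong₂ _∨_

  ∉-∪⁻ : ∀ S T {x} → x ∉ S ∪ T → x ∉ S × x ∉ T
  ∉-∪⁻ S T {x} h = ∨-conicalˡ (S x) (T x) h , ∨-conicalʳ (S x) (T x) h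

  ∈-∩⁻ : ∀ S T {x} → x ∈ S ∩ T → x ∈ S × x ∈ T
  ∈-∩⁻ S T {x} h = ∧-conicalˡ (S x) (T x) h , ∧-conicalʳ (S x) (T x) h

  ∈-∪ˡ : ∀ S T {x} → x ∈ S → x ∈ S ∪ T
  ∈-∪ˡ S T {x} x∈S = cong (_∨ T x) x∈S

  ∈-∪ʳ : ∀ S T {x} → x ∈ T → x ∈ S ∪ T
  ∈-∪ʳ S T {x} x∈T = trans (cong (S x ∨_) x∈T) (∨-zeroʳ (S x))

  ∈-∪⁻ : ∀ S T {x} → x ∈ S ∪ T → x ∈ S ⊎ x ∈ T
  ∈-∪⁻ S T {x} h with S x
  ... | true  = inj₁ refl
  ... | false = inj₂ h

both-or-not : ∀ {P Q : Set} → P ⊎ ¬ P → Q ⊎ ¬ Q → (P × Q) ⊎ (P → ¬ Q)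
both-or-not (inj₁ p) (inj₁ q) = inj₁ (p , q)
both-or-not (inj₁ _) (inj₂ ¬q) = inj₂ (λ _ → ¬q)
both-or-not (inj₂ ¬p) _ = inj₂ (λ p → ⊥-elim (¬p p))

true-or-false : ∀ b → b ≡ true ⊎ b ≡ false
true-or-false true  = inj₁ refl
true-or-false false = inj₂ refl

𝟙 : Bool → ℕ
𝟙 b = if b then 1 else 0

𝟙-mono : ∀ {b c} → (b ≡ true → c ≡ true) → 𝟙 b ≤ 𝟙 c
𝟙-mono {false} _ = z≤n
𝟙-mono {true}  b⇒c rewrite b⇒c refl = ≤-refl

count : ∀ {m} → (Fin m → Bool) → ℕ
count {m} S = ∑[ x < m ] 𝟙 (S x)

∑-mono-≤ : ∀ {n} {f g : Vector ℕ n} → (∀ i → f i ≤ g i) → sum f ≤ sum g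
∑-mono-≤ {zero}  _   = z≤n
∑-mono-≤ {suc n} f≤g = +-mono-≤ (f≤g zero) (∑-mono-≤ (f≤g ∘ suc))

∑-zero : ∀ {n} (f : Vector ℕ n) → (∀ i → f i ≡ 0) → sum f ≡ 0
∑-zero {zero}  f f≡0 = refl
∑-zero {suc n} f f≡0 = cong₂ _+_ (f≡0 zero) (∑-zero (f ∘ suc) (f≡0 ∘ suc))

∑-point : ∀ {n} (c : Fin n) (f : Vector ℕ n) → (∀ i → i ≢ c → f i ≡ 0) → sum f ≡ f c
∑-point {suc n} zero f f≡0 = begin
  f zero + sum (f ∘ suc)  ≡⟨ cong (f zero +_) (∑-zero _ (λ i → f≡0 (suc i) λ ())) ⟩
  f zero + 0              ≡⟨ +-identityʳ _ ⟩
  f zero                  ∎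
  where open ≡-Reasoning
∑-point {suc n} (suc c) f f≡0 =
  cong₂ _+_ (f≡0 zero λ ()) (∑-point c (f ∘ suc) (λ i i≢c → f≡0 (suc i) (i≢c ∘ Fin.suc-injective)))

∑-pos : ∀ {n} (f : Vector ℕ n) → 0 < sum f → ∃ λ i → 0 < f i
∑-pos {suc n} f pos with f zero in eq
... | suc _ = zero , subst (0 <_) (sym eq) (s≤s z≤n)
... | zero  = let i , pos′ = ∑-pos (f ∘ suc) pos in suc i , pos′

module _ {m : ℕ} where

  count-cong : ∀ {S T : Fin m → Bool} → (∀ x → S x ≡ T x) → count S ≡ count T
  count-cong S≗T = sum-cong-≗ (cong 𝟙 ∘ S≗T)

  count-mono : ∀ {S T : Fin m → Bool} → S ⊆ T → count S ≤ count T
  count-mono {S} {T} S⊆T = ∑-mono-≤ {f = 𝟙 ∘ S} {𝟙 ∘ T} (λ _ → 𝟙-mono S⊆T)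

  count-∅ : ∀ {S : Fin m → Bool} → (∀ x → x ∉ S) → count S ≡ 0
  count-∅ x∉S = ∑-zero _ (λ x → cong 𝟙 (x∉S x))

  count-split : ∀ (S T : Fin m → Bool) → count S ≡ count (S ∩ T) + count (S ∩ ∁ T)
  count-split S T = trans (sum-cong-≗ pointwise) (∑-distrib-+ (𝟙 ∘ (S ∩ T)) (𝟙 ∘ (S ∩ ∁ T)))
    where
    pointwise : ∀ x → 𝟙 (S x) ≡ 𝟙 (S x ∧ T x) + 𝟙 (S x ∧ not (T x))
    pointwise x with S x | T x
    ... | true  | true  = refl
    ... | true  | false = refl
    ... | false | _     = refl

  count-≐ : ∀ {S T : Fin m → Bool} → S ⊆ T → T ⊆ S → count S ≡ count T
  count-≐ S⊆T T⊆S = ≤-antisym (count-mono S⊆T) (count-mono T⊆S)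

  count-∪-disjoint : ∀ (S T : Fin m → Bool) → (∀ {x} → x ∈ S → x ∉ T) → count (S ∪ T) ≡ count S + count T
  count-∪-disjoint S T disjoint = trans (sum-cong-≗ pointwise) (∑-distrib-+ (𝟙 ∘ S) (𝟙 ∘ T))
    where
    pointwise : ∀ x → 𝟙 (S x ∨ T x) ≡ 𝟙 (S x) + 𝟙 (T x)
    pointwise x with S x in x∈S
    ... | true  rewrite disjoint x∈S = refl
    ... | false = refl

  count-∩⁅⁆ : ∀ (S : Fin m → Bool) c → count (S ∩ ⁅ c ⁆) ≡ 𝟙 (S c)
  count-∩⁅⁆ S c = trans (∑-point c _ off-c) (cong 𝟙 (trans (cong (S c ∧_) (∈-⁅⁆ c)) (∧-identityʳ (S c))))
    where
    off-c : ∀ x → x ≢ c → 𝟙 (S x ∧ ⁅ c ⁆ x) ≡ 0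
    off-c x x≢c = cong 𝟙 (trans (cong (S x ∧_) (∉-⁅⁆ x≢c)) (∧-zeroʳ (S x)))

  count-⁅⁆ : ∀ c → count ⁅ c ⁆ ≡ 1
  count-⁅⁆ = count-∩⁅⁆ (λ _ → true)

  ∈⇒count-pos : ∀ {S : Fin m → Bool} {c} → c ∈ S → 0 < count S
  ∈⇒count-pos {S} {c} c∈S =
    subst (_≤ count S) (count-⁅⁆ c)
      (count-mono {⁅ c ⁆} {S} (λ x∈⁅c⁆ → subst (_∈ S) (sym (∈-⁅⁆⁻ x∈⁅c⁆)) c∈S))

  count-pos⇒∈ : ∀ {S : Fin m → Bool} → 0 < count S → ∃ (_∈ S)
  count-pos⇒∈ {S} pos with ∑-pos _ pos
  ... | x , pos′ with S x in x∈S
  ...   | true = x , x∈S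

  count≤ : ∀ (S : Fin m → Bool) → count S ≤ m
  count≤ S = subst (count S ≤_) (all≡m m) (count-mono {T = λ _ → true} (λ _ → refl))
    where
    all≡m : ∀ n → count {n} (λ _ → true) ≡ n
    all≡m zero    = refl
    all≡m (suc n) = cong suc (all≡m n)

  count-⊂ : ∀ {S T : Fin m → Bool} {c} → S ⊆ T → c ∈ T → c ∉ S → count S < count T
  count-⊂ {S} {T} {c} S⊆T c∈T c∉S = begin-strict
    count S                           ≡⟨ count-cong (λ x → sym (T∩S≗S x)) ⟩
    count (T ∩ S)                     <⟨ m<m+n _ (∈⇒count-pos {S = T ∩ ∁ S} {c} (cong₂ _∧_ c∈T (cong not c∉S))) ⟩
    count (T ∩ S) + count (T ∩ ∁ S)   ≡⟨ count-split T S ⟨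
    count T                           ∎
    where
    open ≤-Reasoning
    T∩S≗S : ∀ x → T x ∧ S x ≡ S x
    T∩S≗S x with S x in x∈S
    ... | true  = cong (_∧ true) (S⊆T x∈S)
    ... | false = ∧-zeroʳ (T x)

  count-≡-nonempty : ∀ {S T : Fin m → Bool} {x} → count S ≡ count T → x ∈ S → ∃ (_∈ T)
  count-≡-nonempty {S} {T} S≡T x∈S = count-pos⇒∈ (subst (0 <_) S≡T (∈⇒count-pos {S = S} x∈S))

  count-pair : ∀ (a c : Fin m) → count (⁅ a ⁆ ∪ ⁅ c ⁆) + 𝟙 (⁅ c ⁆ a) ≡ 2
  count-pair a c with a ≡? c
  ... | inj₁ refl = cong₂ _+_ (trans (count-cong (λ x → ∨-idem (⁅ a ⁆ x))) (count-⁅⁆ a)) (cong 𝟙 (∈-⁅⁆ a))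
  ... | inj₂ a≢c = begin
    count (⁅ a ⁆ ∪ ⁅ c ⁆) + 𝟙 (⁅ c ⁆ a)
      ≡⟨ cong₂ _+_ (count-∪-disjoint ⁅ a ⁆ ⁅ c ⁆ disjoint) (cong 𝟙 (∉-⁅⁆ a≢c)) ⟩
    count ⁅ a ⁆ + count ⁅ c ⁆ + 0
      ≡⟨ cong₂ (λ p q → p + q + 0) (count-⁅⁆ a) (count-⁅⁆ c) ⟩
    2 ∎
    where
    open ≡-Reasoning
    disjoint : ∀ {x} → x ∈ ⁅ a ⁆ → x ∉ ⁅ c ⁆
    disjoint x∈⁅a⁆ = ∉-⁅⁆ (λ x≡c → a≢c (trans (sym (∈-⁅⁆⁻ x∈⁅a⁆)) x≡c))

  count-injection : ∀ {S T : Fin m → Bool} (f g : Fin m → Fin m) →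
    (∀ {x} → x ∈ S → f x ∈ T × g (f x) ≡ x) → count S ≤ count T
  count-injection {S} {T} f g inj = begin
    count S
      ≡⟨ sum-cong-≗ (λ x → count-∩⁅⁆ (λ _ → S x) (f x)) ⟨
    ∑[ x < m ] ∑[ y < m ] 𝟙 (S x ∧ ⁅ f x ⁆ y)
      ≡⟨ ∑-comm (λ x y → 𝟙 (S x ∧ ⁅ f x ⁆ y)) ⟩
    ∑[ y < m ] ∑[ x < m ] 𝟙 (S x ∧ ⁅ f x ⁆ y)
      ≤⟨ ∑-mono-≤ (λ y → ∑-mono-≤ (λ x → 𝟙-mono (pointwise x y))) ⟩
    ∑[ y < m ] ∑[ x < m ] 𝟙 (T y ∧ ⁅ g y ⁆ x)
      ≡⟨ sum-cong-≗ (λ y → count-∩⁅⁆ (λ _ → T y) (g y)) ⟩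
    count T ∎
    where
    open ≤-Reasoning
    pointwise : ∀ x y → S x ∧ ⁅ f x ⁆ y ≡ true → T y ∧ ⁅ g y ⁆ x ≡ true
    pointwise x y h with ∈-∩⁻ (λ _ → S x) ⁅ f x ⁆ h
    ... | x∈S , y∈⁅fx⁆ with ∈-⁅⁆⁻ y∈⁅fx⁆
    ...   | refl = let fx∈T , gfx≡x = inj x∈S in cong₂ _∧_ fx∈T (≡⇒∈-⁅⁆ (sym gfx≡x))

  ∑-count-regular : ∀ (S : Fin m → Bool) (P : Fin m → Fin m → Bool) {k} →
    (∀ {x} → x ∈ S → count (P x) ≡ k) → ∑[ x < m ] count (λ y → S x ∧ P x y) ≡ count S * k
  ∑-count-regular S P {k} reg = begin
    ∑[ x < m ] count (λ y → S x ∧ P x y)   ≡⟨ sum-cong-≗ pointwise ⟩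
    ∑[ x < m ] (𝟙 (S x) * k)               ≡⟨ *-distribʳ-sum k (𝟙 ∘ S) ⟨
    count S * k                            ∎
    where
    open ≡-Reasoning
    pointwise : ∀ x → count (λ y → S x ∧ P x y) ≡ 𝟙 (S x) * k
    pointwise x with S x in x∈S
    ... | true  = trans (reg x∈S) (sym (+-identityʳ k))
    ... | false = count-∅ (λ _ → refl)

-- Matchings

module _ {m : ℕ} where

  link : Fin m → Fin m → (Fin m → Fin m) → Fin m → Fin m
  link p q μ x = if ⌊ x ≟ p ⌋ then q else if ⌊ x ≟ q ⌋ then p else μ x

  unlink : Fin m → (Fin m → Fin m) → Fin m → Fin m
  unlink c μ x = if ⌊ x ≟ c ⌋ then x else μ x

  link-at-p : ∀ p q μ → link p q μ p ≡ q
  link-at-p p q μ with p ≟ p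
  ... | yes _   = refl
  ... | no p≢p  = ⊥-elim (p≢p refl)

  link-at-q : ∀ {p q} μ → p ≢ q → link p q μ q ≡ p
  link-at-q {p} {q} μ p≢q with q ≟ p | q ≟ q
  ... | yes q≡p | _      = ⊥-elim (p≢q (sym q≡p))
  ... | no _    | yes _  = refl
  ... | no _    | no q≢q = ⊥-elim (q≢q refl)

  link-elsewhere : ∀ {p q x} μ → x ≢ p → x ≢ q → link p q μ x ≡ μ x
  link-elsewhere {p} {q} {x} μ x≢p x≢q with x ≟ p | x ≟ q
  ... | yes x≡p | _       = ⊥-elim (x≢p x≡p)
  ... | no _    | yes x≡q = ⊥-elim (x≢q x≡q)
  ... | no _    | no _    = refl

  link-fixed : ∀ {p q x} μ → p ≢ q → link p q μ x ≡ x → x ≢ p × x ≢ q × μ x ≡ x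
  link-fixed {p} {q} {x} μ p≢q fixed with x ≟ p | x ≟ q
  ... | yes refl | _        = ⊥-elim (p≢q (sym fixed))
  ... | no x≢p   | yes refl = ⊥-elim (p≢q fixed)
  ... | no x≢p   | no x≢q   = x≢p , x≢q , fixed

  unlink-at : ∀ c μ → unlink c μ c ≡ c
  unlink-at c μ with c ≟ c
  ... | yes _  = refl
  ... | no c≢c = ⊥-elim (c≢c refl)

  unlink-elsewhere : ∀ {c x} μ → x ≢ c → unlink c μ x ≡ μ x
  unlink-elsewhere {c} {x} μ x≢c with x ≟ c
  ... | yes x≡c = ⊥-elim (x≢c x≡c)
  ... | no _    = refl

  unlink-fixed : ∀ {c x} μ → unlink c μ x ≡ x → x ≡ c ⊎ μ x ≡ x
  unlink-fixed {c} {x} μ fixed with x ≟ c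
  ... | yes x≡c = inj₁ x≡c
  ... | no _    = inj₂ fixed

  glue : (Fin m → Bool) → (Fin m → Fin m) → (Fin m → Fin m) → Fin m → Fin m
  glue C μ ν x = if C x then μ x else ν x

  glue-∈ : ∀ {C μ ν x} → x ∈ C → glue C μ ν x ≡ μ x
  glue-∈ x∈C rewrite x∈C = refl

  glue-∉ : ∀ {C μ ν x} → x ∉ C → glue C μ ν x ≡ ν x
  glue-∉ x∉C rewrite x∉C = refl

module _ {m : ℕ} (E : Fin m → Fin m → Bool) where

  record Matched (R : Fin m → Bool) (μ : Fin m → Fin m) (x : Fin m) : Set where
    constructor matched
    field
      partner∈ : μ x ∈ R
      partner≢ : μ x ≢ x
      involutive : μ (μ x) ≡ x
      edge : E x (μ x) ≡ true

  IsMatching : (Fin m → Bool) → (Fin m → Fin m) → Set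
  IsMatching R μ = ∀ {x} → x ∈ R → μ x ≡ x ⊎ Matched R μ x

  IsPerfectMatching : (Fin m → Bool) → (Fin m → Fin m) → Set
  IsPerfectMatching R μ = ∀ {x} → x ∈ R → Matched R μ x

  matched-by : ∀ {R ν x y} → ν x ≡ y → ν y ≡ x → y ∈ R → y ≢ x → E x y ≡ true → Matched R ν x
  matched-by refl νy≡x y∈R y≢x Exy = matched y∈R y≢x νy≡x Exy

  matched-sym : ∀ {R μ x y} → Matched R μ x → μ x ≡ y → μ y ≡ x
  matched-sym {μ = μ} x-matched μx≡y = trans (cong μ (sym μx≡y)) (Matched.involutive x-matched)

  partner-not-fixed : ∀ {R μ x y} → Matched R μ x → μ y ≡ y → μ x ≢ y
  partner-not-fixed x-matched μy≡y μx≡y =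
    Matched.partner≢ x-matched (trans μx≡y (trans (sym μy≡y) (matched-sym x-matched μx≡y)))

  link-matching : ∀ {R μ p q} → IsMatching R μ → p ∈ R → q ∈ R → p ≢ q → μ p ≡ p → μ q ≡ q →
                  E p q ≡ true → E q p ≡ true → IsMatching R (link p q μ)
  link-matching {R} {μ} {p} {q} μ-matching p∈R q∈R p≢q μp≡p μq≡q Epq Eqp {x} x∈R
    with x ≡? p | x ≡? q
  ... | inj₁ refl | _ = inj₂ (matched-by (link-at-p x q μ) (link-at-q μ p≢q) q∈R (p≢q ∘ sym) Epq)
  ... | inj₂ _ | inj₁ refl = inj₂ (matched-by (link-at-q μ p≢q) (link-at-p p x μ) p∈R p≢q Eqp)
  ... | inj₂ x≢p | inj₂ x≢q with μ-matching x∈R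
  ...   | inj₁ μx≡x = inj₁ (trans (link-elsewhere μ x≢p x≢q) μx≡x)
  ...   | inj₂ x-matched@(matched μx∈R μx≢x μμx≡x Exμx) =
          let μx≢p = partner-not-fixed x-matched μp≡p
              μx≢q = partner-not-fixed x-matched μq≡q
          in inj₂ (matched-by (link-elsewhere μ x≢p x≢q) (trans (link-elsewhere μ μx≢p μx≢q) μμx≡x) μx∈R μx≢x Exμx)

  unpair-matching : ∀ {R μ c d} → IsMatching R μ → Matched R μ c → μ c ≡ d → IsMatching R (unlink d (unlink c μ))
  unpair-matching {R} {μ} {c} μ-matching c-matched refl {x} x∈R with x ≡? μ c | x ≡? c
  ... | inj₁ refl | _ = inj₁ (unlink-at (μ c) (unlink c μ))
  ... | inj₂ x≢μc | inj₁ refl = inj₁ (trans (unlink-elsewhere (unlink x μ) x≢μc) (unlink-at x μ))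
  ... | inj₂ x≢μc | inj₂ x≢c with μ-matching x∈R
  ...   | inj₁ μx≡x = inj₁ (trans (unlink-elsewhere (unlink c μ) x≢μc) (trans (unlink-elsewhere μ x≢c) μx≡x))
  ...   | inj₂ x-matched@(matched μx∈R μx≢x μμx≡x Exμx) =
          inj₂ (matched-by (trans (unlink-elsewhere (unlink c μ) x≢μc) (unlink-elsewhere μ x≢c))
                  (trans (unlink-elsewhere (unlink c μ) μx≢μc) (trans (unlink-elsewhere μ μx≢c) μμx≡x))
                  μx∈R μx≢x Exμx)
    where
    μx≢c : μ x ≢ c
    μx≢c μx≡c = x≢μc (sym (matched-sym x-matched μx≡c))
    μx≢μc : μ x ≢ μ c
    μx≢μc μx≡μc = x≢c (trans (sym μμx≡x) (trans (cong μ μx≡μc) (Matched.involutive c-matched)))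

perfectMatching-mono : ∀ {m} {E F : Fin m → Fin m → Bool} {R μ} →
  (∀ {x} → x ∈ R → F x (μ x) ≡ true → E x (μ x) ≡ true) → IsPerfectMatching F R μ → IsPerfectMatching E R μ
perfectMatching-mono F⊆E μ-perfect x∈R =
  let matched μx∈R μx≢x μμx≡x Fxμx = μ-perfect x∈R in matched μx∈R μx≢x μμx≡x (F⊆E x∈R Fxμx)

module _ {m} {E : Fin m → Fin m → Bool} where

  perfectMatching-restrict : ∀ {R S μ} → IsPerfectMatching E R μ → S ⊆ R → (∀ {x} → x ∈ S → μ x ∈ S) →
                             IsPerfectMatching E S μ
  perfectMatching-restrict μ-perfect S⊆R closed x∈S =
    let matched _ μx≢x μμx≡x Exμx = μ-perfect (S⊆R x∈S) in matched (closed x∈S) μx≢x μμx≡x Exμx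

  perfectMatching-patch : ∀ {P Q R μ ν} C → IsPerfectMatching E P μ → IsPerfectMatching E Q ν →
    (∀ {x} → x ∈ R → x ∈ C → x ∈ P × μ x ∈ R × μ x ∈ C) →
    (∀ {x} → x ∈ R → x ∉ C → x ∈ Q × ν x ∈ R × ν x ∉ C) →
    IsPerfectMatching E R (glue C μ ν)
  perfectMatching-patch {μ = μ} {ν} C μ-perfect ν-perfect inside outside {x} x∈R with C x in x∈C
  ... | true  = let x∈P , μx∈R , μx∈C = inside x∈R x∈C
                    matched _ μx≢x μμx≡x Exμx = μ-perfect x∈P
                in matched-by E (glue-∈ {C = C} {μ} {ν} x∈C)
                     (trans (glue-∈ {C = C} {μ} {ν} μx∈C) μμx≡x) μx∈R μx≢x Exμx
  ... | false = let x∈Q , νx∈R , νx∉C = outside x∈R x∈C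
                    matched _ νx≢x ννx≡x Exνx = ν-perfect x∈Q
                in matched-by E (glue-∉ {C = C} {μ} {ν} x∈C)
                     (trans (glue-∉ {C = C} {μ} {ν} νx∉C) ννx≡x) νx∈R νx≢x Exνx

  pair-perfectMatching : ∀ {p q} → p ≢ q → E p q ≡ true → E q p ≡ true →
                         IsPerfectMatching E (⁅ p ⁆ ∪ ⁅ q ⁆) (link p q id)
  pair-perfectMatching {p} {q} p≢q Epq Eqp {x} x∈pq with x ≡? p | x ≡? q
  ... | inj₁ refl | _ =
    matched-by E (link-at-p x q id) (link-at-q id p≢q) (∈-∪ʳ ⁅ x ⁆ ⁅ q ⁆ (∈-⁅⁆ q)) (p≢q ∘ sym) Epq
  ... | inj₂ _ | inj₁ refl =
    matched-by E (link-at-q id p≢q) (link-at-p p x id) (∈-∪ˡ ⁅ p ⁆ ⁅ x ⁆ (∈-⁅⁆ p)) p≢q Eqp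
  ... | inj₂ x≢p | inj₂ x≢q = ⊥-elim ([ x≢p ∘ ∈-⁅⁆⁻ , x≢q ∘ ∈-⁅⁆⁻ ]′ (∈-∪⁻ ⁅ p ⁆ ⁅ q ⁆ x∈pq))

module _ {m} {E : Fin m → Fin m → Bool} {R : Fin m → Bool} where

  fromHasPerfectMatching : HasPerfectMatching E R → ∃ (IsPerfectMatching E R)
  fromHasPerfectMatching (μ , μ-perfect) = μ , λ {x} x∈R → let p , q , r , s = μ-perfect x x∈R in matched p q r s

  toHasPerfectMatching : ∃ (IsPerfectMatching E R) → HasPerfectMatching E R
  toHasPerfectMatching (μ , μ-perfect) = μ , λ x x∈R → let matched p q r s = μ-perfect x∈R in p , q , r , s

-- König's theorem

record IsRegularBipartite {m} (E : Fin m → Fin m → Bool) (R col : Fin m → Bool) (k : ℕ) : Set where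
  field
    symmetric : ∀ {x y} → x ∈ R → y ∈ R → E x y ≡ E y x
    bipartite : ∀ {x y} → x ∈ R → y ∈ R → E x y ≡ true → col x ≢ col y
    regular   : ∀ {x} → x ∈ R → count (R ∩ E x) ≡ k

record Augmentation {m} (E : Fin m → Fin m → Bool) (R : Fin m → Bool) (μ : Fin m → Fin m) (a₀ : Fin m) : Set where
  field
    ν              : Fin m → Fin m
    matching       : IsMatching E R ν
    exposed-before : ∀ {x} → x ∈ R → ν x ≡ x → μ x ≡ x × x ≢ a₀

both-≢⇒≡ : ∀ {x y z : Bool} → x ≢ y → z ≢ y → x ≡ z
both-≢⇒≡ x≢y z≢y = trans (¬-not x≢y) (sym (¬-not z≢y))

module AlternatingTree {m} {E : Fin m → Fin m → Bool} {R col : Fin m → Bool} {k}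
  (G : IsRegularBipartite E R col (suc k))
  {μ} (μ-matching : IsMatching E R μ) {a₀} (a₀∈R : a₀ ∈ R) (a₀-exposed : μ a₀ ≡ a₀) where

  open IsRegularBipartite G

  -- ν is μ switched along the tree path from a₀ to a; it agrees with μ away from S and its partners.
  record Switch (S : Fin m → Bool) (a : Fin m) : Set where
    field
      ν              : Fin m → Fin m
      matching       : IsMatching E R ν
      a-exposed      : ν a ≡ a
      exposed-before : ∀ {x} → x ∈ R → ν x ≡ x → (μ x ≡ x × x ≢ a₀) ⊎ x ≡ a
      agrees         : ∀ {x} → x ∉ S → μ x ∉ S → ν x ≡ μ x

  record Tree (S : Fin m → Bool) : Set where
    field
      root   : a₀ ∈ S
      inside : S ⊆ R
      colour : ∀ {a} → a ∈ S → col a ≡ col a₀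
      switch : ∀ {a} → a ∈ S → Switch S a

  root-tree : Tree ⁅ a₀ ⁆
  root-tree = record
    { root   = ∈-⁅⁆ a₀
    ; inside = λ a∈⁅a₀⁆ → subst (_∈ R) (sym (∈-⁅⁆⁻ a∈⁅a₀⁆)) a₀∈R
    ; colour = λ a∈⁅a₀⁆ → cong col (∈-⁅⁆⁻ a∈⁅a₀⁆)
    ; switch = λ a∈⁅a₀⁆ → record
      { ν              = μ
      ; matching       = μ-matching
      ; a-exposed      = subst (λ a → μ a ≡ a) (sym (∈-⁅⁆⁻ a∈⁅a₀⁆)) a₀-exposed
      ; exposed-before = λ {x} _ μx≡x →
          [ (λ x≡a₀ → inj₂ (trans x≡a₀ (sym (∈-⁅⁆⁻ a∈⁅a₀⁆)))) , (λ x≢a₀ → inj₁ (μx≡x , x≢a₀)) ]′ (x ≡? a₀)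
      ; agrees         = λ _ _ → refl
      }
    }

  module _ {S} (T : Tree S) {a b} (a∈S : a ∈ S) (b∈R : b ∈ R) (Eab : E a b ≡ true) where
    open Tree T
    open Switch (switch a∈S)

    private
      a∈R : a ∈ R
      a∈R = inside a∈S

      Eba : E b a ≡ true
      Eba = trans (symmetric b∈R a∈R) Eab

      colour-a≢b : col a ≢ col b
      colour-a≢b = bipartite a∈R b∈R Eab

      a≢b : a ≢ b
      a≢b = colour-a≢b ∘ cong col

      b∉S : b ∉ S
      b∉S = ¬-not (λ b∈S → colour-a≢b (trans (colour a∈S) (sym (colour b∈S))))

    augment : μ b ≡ b → Augmentation E R μ a₀
    augment μb≡b = record
      { ν              = link a b ν
      ; matching       = link-matching E matching a∈R b∈R a≢b a-exposed νb≡b Eab Eba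
      ; exposed-before = λ x∈R fixed → let x≢a , x≢b , νx≡x = link-fixed ν a≢b fixed in
                           [ id , ⊥-elim ∘ x≢a ]′ (exposed-before x∈R νx≡x)
      }
      where
      νb≡b : ν b ≡ b
      νb≡b = trans (agrees b∉S (subst (_∉ S) (sym μb≡b) b∉S)) μb≡b

    extend : μ b ≢ b → μ b ∉ S → Tree (S ∪ ⁅ μ b ⁆)
    extend μb≢b a′∉S = record
      { root   = ∈-∪ˡ S ⁅ a′ ⁆ root
      ; inside = [ inside , (λ x≡a′ → subst (_∈ R) (sym (∈-⁅⁆⁻ x≡a′)) a′∈R) ]′ ∘ ∈-∪⁻ S ⁅ a′ ⁆
      ; colour = [ colour , (λ x≡a′ → trans (cong col (∈-⁅⁆⁻ x≡a′)) colour-a′) ]′ ∘ ∈-∪⁻ S ⁅ a′ ⁆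
      ; switch = [ weaken ∘ switch , (λ x≡a′ → subst (Switch (S ∪ ⁅ a′ ⁆)) (sym (∈-⁅⁆⁻ x≡a′)) switch-a′) ]′
                 ∘ ∈-∪⁻ S ⁅ a′ ⁆
      }
      where
      a′ : Fin m
      a′ = μ b

      b-matched : Matched E R μ b
      b-matched = [ (λ μb≡b → ⊥-elim (μb≢b μb≡b)) , id ]′ (μ-matching b∈R)

      a′∈R : a′ ∈ R
      a′∈R = Matched.partner∈ b-matched

      colour-a′ : col a′ ≡ col a₀
      colour-a′ = trans (both-≢⇒≡ (bipartite b∈R a′∈R (Matched.edge b-matched) ∘ sym) colour-a≢b) (colour a∈S)

      νb≡a′ : ν b ≡ a′
      νb≡a′ = agrees b∉S a′∉S

      b-ν-matched : Matched E R ν b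
      b-ν-matched = [ (λ νb≡b → ⊥-elim (μb≢b (trans (sym νb≡a′) νb≡b))) , id ]′ (matching b∈R)

      a≢a′ : a ≢ a′
      a≢a′ = ∈∉⇒≢ a∈S a′∉S

      b≢a′ : b ≢ a′
      b≢a′ = μb≢b ∘ sym

      -- b leaves its partner a′ for a, which exposes a′ instead of a.
      ν′ : Fin m → Fin m
      ν′ = link a b (unlink a′ (unlink b ν))

      weaken : ∀ {c} → Switch S c → Switch (S ∪ ⁅ a′ ⁆) c
      weaken σ = record
        { ν              = Switch.ν σ
        ; matching       = Switch.matching σ
        ; a-exposed      = Switch.a-exposed σ
        ; exposed-before = Switch.exposed-before σ
        ; agrees         = λ x∉ μx∉ →
            Switch.agrees σ (proj₁ (∉-∪⁻ S ⁅ a′ ⁆ x∉)) (proj₁ (∉-∪⁻ S ⁅ a′ ⁆ μx∉))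
        }

      switch-a′ : Switch (S ∪ ⁅ a′ ⁆) a′
      switch-a′ = record
        { ν              = ν′
        ; matching       = link-matching E (unpair-matching E matching b-ν-matched νb≡a′) a∈R b∈R a≢b
                             (trans (unlink-elsewhere (unlink b ν) a≢a′) (trans (unlink-elsewhere ν a≢b) a-exposed))
                             (trans (unlink-elsewhere (unlink b ν) b≢a′) (unlink-at b ν)) Eab Eba
        ; a-exposed      = trans (link-elsewhere (unlink a′ (unlink b ν)) (a≢a′ ∘ sym) (b≢a′ ∘ sym))
                                 (unlink-at a′ (unlink b ν))
        ; exposed-before = exposed′
        ; agrees         = agrees′
        }
        where
        exposed′ : ∀ {x} → x ∈ R → ν′ x ≡ x → (μ x ≡ x × x ≢ a₀) ⊎ x ≡ a′
        exposed′ x∈R fixed with link-fixed (unlink a′ (unlink b ν)) a≢b fixed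
        ... | x≢a , x≢b , fixed′ with unlink-fixed (unlink b ν) fixed′
        ...   | inj₁ x≡a′ = inj₂ x≡a′
        ...   | inj₂ fixed″ with unlink-fixed ν fixed″
        ...     | inj₁ x≡b = ⊥-elim (x≢b x≡b)
        ...     | inj₂ νx≡x = [ inj₁ , (λ x≡a → ⊥-elim (x≢a x≡a)) ]′ (exposed-before x∈R νx≡x)

        agrees′ : ∀ {x} → x ∉ S ∪ ⁅ a′ ⁆ → μ x ∉ S ∪ ⁅ a′ ⁆ → ν′ x ≡ μ x
        agrees′ {x} x∉ μx∉ =
          let x∉S , x∉a′ = ∉-∪⁻ S ⁅ a′ ⁆ x∉
              μx∉S , μx∉a′ = ∉-∪⁻ S ⁅ a′ ⁆ μx∉
              x≢a : x ≢ a
              x≢a = ∈∉⇒≢ a∈S x∉S ∘ sym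
              x≢b : x ≢ b
              x≢b x≡b = ∉-⁅⁆⁻ μx∉a′ (cong μ x≡b)
          in trans (link-elsewhere (unlink a′ (unlink b ν)) x≢a x≢b)
               (trans (unlink-elsewhere (unlink b ν) (∉-⁅⁆⁻ x∉a′))
                      (trans (unlink-elsewhere ν x≢b) (agrees x∉S μx∉S)))

  -- The (k + 1)·|S| edges at S all end at vertices matched into S minus a₀, and these carry at most
  -- (k + 1)·(|S| − 1) edges.
  closed-tree-impossible : ∀ {S} → Tree S →
    (∀ {a b} → a ∈ S → b ∈ R → E a b ≡ true → μ b ≢ b × μ b ∈ S) → ⊥
  closed-tree-impossible {S} T closed = <-irrefl refl (begin-strict
    count S * suc k
      ≡⟨ ∑-count-regular S (λ a → R ∩ E a) (regular ∘ inside) ⟨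
    ∑[ a < m ] count (λ b → S a ∧ (R ∩ E a) b)
      ≤⟨ ∑-mono-≤ (λ a → ∑-mono-≤ (λ b → 𝟙-mono (edge-into a b))) ⟩
    ∑[ a < m ] ∑[ b < m ] 𝟙 (into b ∧ (R ∩ E b) a)
      ≡⟨ ∑-comm (λ a b → 𝟙 (into b ∧ (R ∩ E b) a)) ⟩
    ∑[ b < m ] count (λ a → into b ∧ (R ∩ E b) a)
      ≡⟨ ∑-count-regular into (λ b → R ∩ E b) (regular ∘ into⊆R) ⟩
    count into * suc k
      ≤⟨ *-monoˡ-≤ (suc k) (count-injection {S = into} μ μ into↪S) ⟩
    count (S ∩ ∁ ⁅ a₀ ⁆) * suc k
      <⟨ *-monoˡ-< (suc k) (count-⊂ {S = S ∩ ∁ ⁅ a₀ ⁆} {S} (proj₁ ∘ ∈-∩⁻ S (∁ ⁅ a₀ ⁆)) root a₀∉) ⟩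
    count S * suc k ∎)
    where
    open ≤-Reasoning
    open Tree T

    into : Fin m → Bool
    into = R ∩ ∁ (λ b → ⁅ b ⁆ (μ b)) ∩ (S ∘ μ)

    ∈-into⁻ : ∀ {b} → b ∈ into → b ∈ R × μ b ≢ b × μ b ∈ S
    ∈-into⁻ {b} h =
      let b∈R , rest = ∈-∩⁻ R (∁ (λ b → ⁅ b ⁆ (μ b)) ∩ (S ∘ μ)) h
          μb≢b , μb∈S = ∈-∩⁻ (∁ (λ b → ⁅ b ⁆ (μ b))) (S ∘ μ) rest
      in b∈R , ∉-⁅⁆⁻ (∈-∁⁻ (λ b → ⁅ b ⁆ (μ b)) μb≢b) , μb∈S

    into⊆R : into ⊆ R
    into⊆R = proj₁ ∘ ∈-into⁻

    edge-into : ∀ a b → S a ∧ (R ∩ E a) b ≡ true → into b ∧ (R ∩ E b) a ≡ true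
    edge-into a b h =
      let a∈S , b∈R∩Ea = ∈-∩⁻ (λ _ → S a) (R ∩ E a) h
          b∈R , Eab = ∈-∩⁻ R (E a) b∈R∩Ea
          μb≢b , μb∈S = closed a∈S b∈R Eab
      in cong₂ _∧_ (cong₂ _∧_ b∈R (cong₂ _∧_ (∈-∁ (λ b → ⁅ b ⁆ (μ b)) (∉-⁅⁆ μb≢b)) μb∈S))
                   (cong₂ _∧_ (inside a∈S) (trans (symmetric b∈R (inside a∈S)) Eab))

    into↪S : ∀ {b} → b ∈ into → μ b ∈ S ∩ ∁ ⁅ a₀ ⁆ × μ (μ b) ≡ b
    into↪S b∈into =
      let b∈R , μb≢b , μb∈S = ∈-into⁻ b∈into
          b-matched = [ (λ μb≡b → ⊥-elim (μb≢b μb≡b)) , id ]′ (μ-matching b∈R)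
          μb≢a₀ : μ _ ≢ a₀
          μb≢a₀ = partner-not-fixed E b-matched a₀-exposed
      in cong₂ _∧_ μb∈S (∈-∁ ⁅ a₀ ⁆ (∉-⁅⁆ μb≢a₀)) , Matched.involutive b-matched

    a₀∉ : a₀ ∉ S ∩ ∁ ⁅ a₀ ⁆
    a₀∉ = trans (cong (S a₀ ∧_) (cong not (∈-⁅⁆ a₀))) (∧-zeroʳ (S a₀))

  private
    frontier? : ∀ S a b → Dec (a ∈ S × b ∈ R × E a b ≡ true × (μ b ≡ b ⊎ μ b ∉ S))
    frontier? S a b =
      S a Bool.≟ true ×-dec R b Bool.≟ true ×-dec E a b Bool.≟ true ×-dec (μ b ≟ b ⊎-dec S (μ b) Bool.≟ false)

  mutual
    grow : ∀ n {S} → Tree S → m ≤ n + count S → Augmentation E R μ a₀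
    grow n {S} T bound with any? (λ a → any? (frontier? S a))
    ... | no none = ⊥-elim (closed-tree-impossible T closed)
      where
      closed : ∀ {a b} → a ∈ S → b ∈ R → E a b ≡ true → μ b ≢ b × μ b ∈ S
      closed a∈S b∈R Eab = (λ μb≡b → none (_ , _ , a∈S , b∈R , Eab , inj₁ μb≡b))
                         , ¬-not (λ μb∉S → none (_ , _ , a∈S , b∈R , Eab , inj₂ μb∉S))
    ... | yes (a , b , a∈S , b∈R , Eab , inj₁ μb≡b) = augment T a∈S b∈R Eab μb≡b
    ... | yes (a , b , a∈S , b∈R , Eab , inj₂ μb∉S) with μ b ≡? b
    ...   | inj₁ μb≡b = augment T a∈S b∈R Eab μb≡b
    ...   | inj₂ μb≢b = grow-with n {S} (extend T a∈S b∈R Eab μb≢b μb∉S) bigger bound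
      where
      bigger : count S < count (S ∪ ⁅ μ b ⁆)
      bigger = count-⊂ {S = S} (∈-∪ˡ S ⁅ μ b ⁆) (∈-∪ʳ S ⁅ μ b ⁆ (∈-⁅⁆ (μ b))) μb∉S

    grow-with : ∀ n {S S′} → Tree S′ → count S < count S′ → m ≤ n + count S → Augmentation E R μ a₀
    grow-with zero    {S′ = S′} T′ bigger bound =
      ⊥-elim (<-irrefl refl (<-≤-trans bigger (≤-trans (count≤ S′) bound)))
    grow-with (suc n) {S} {S′} T′ bigger bound = grow n T′ (begin
      m                 ≤⟨ bound ⟩
      suc n + count S   ≡⟨ +-suc n (count S) ⟨
      n + suc (count S) ≤⟨ +-monoʳ-≤ n bigger ⟩
      n + count S′      ∎)
      where open ≤-Reasoning

  augmentation : Augmentation E R μ a₀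
  augmentation = grow m {⁅ a₀ ⁆} root-tree (m≤m+n m (count ⁅ a₀ ⁆))

_∖_ : ∀ {m} → (Fin m → Fin m → Bool) → (Fin m → Fin m) → Fin m → Fin m → Bool
(E ∖ μ) x y = E x y ∧ not (⁅ μ x ⁆ y)

exposed : ∀ {m} → (Fin m → Bool) → (Fin m → Fin m) → Fin m → Bool
exposed R μ = R ∩ (λ x → ⁅ x ⁆ (μ x))

module _ {m} {R col : Fin m → Bool} where

  private
    augmentation-step : ∀ {E k} → IsRegularBipartite E R col (suc k) → ∀ {μ} → IsMatching E R μ →
      ∀ {a₀} → a₀ ∈ R → μ a₀ ≡ a₀ → ∃ λ ν → IsMatching E R ν × count (exposed R ν) < count (exposed R μ)
    augmentation-step G {μ} μ-matching {a₀} a₀∈R μa₀≡a₀ =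
      ν , matching , count-⊂ {S = exposed R ν} {exposed R μ} fewer a₀-exposed-in-μ a₀-covered-in-ν
      where
      open Augmentation (AlternatingTree.augmentation G μ-matching a₀∈R μa₀≡a₀)

      fewer : exposed R ν ⊆ exposed R μ
      fewer {x} x∈ =
        let x∈R , νx≡x = ∈-∩⁻ R (λ x → ⁅ x ⁆ (ν x)) x∈
        in cong₂ _∧_ x∈R (subst (_∈ ⁅ x ⁆) (sym (proj₁ (exposed-before x∈R (∈-⁅⁆⁻ νx≡x)))) (∈-⁅⁆ x))

      a₀-exposed-in-μ : a₀ ∈ exposed R μ
      a₀-exposed-in-μ = cong₂ _∧_ a₀∈R (subst (_∈ ⁅ a₀ ⁆) (sym μa₀≡a₀) (∈-⁅⁆ a₀))

      a₀-covered-in-ν : a₀ ∉ exposed R ν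
      a₀-covered-in-ν =
        trans (cong (R a₀ ∧_) (∉-⁅⁆ (λ νa₀≡a₀ → proj₂ (exposed-before a₀∈R νa₀≡a₀) refl)))
              (∧-zeroʳ (R a₀))

  regular-bipartite⇒perfectMatching : ∀ {E k} → IsRegularBipartite E R col (suc k) → ∃ (IsPerfectMatching E R)
  regular-bipartite⇒perfectMatching {E} {k} G = saturate m id (λ _ → inj₁ refl) (count≤ (exposed R id))
    where
    saturate : ∀ n μ → IsMatching E R μ → count (exposed R μ) ≤ n → ∃ (IsPerfectMatching E R)
    saturate n μ μ-matching bound with any? (λ x → R x Bool.≟ true ×-dec μ x ≟ x)
    ... | no none = μ , λ {x} x∈R → [ (λ μx≡x → ⊥-elim (none (x , x∈R , μx≡x))) , id ]′ (μ-matching x∈R)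
    ... | yes (a₀ , a₀∈R , μa₀≡a₀) with augmentation-step G μ-matching a₀∈R μa₀≡a₀
    saturate zero    μ _ bound | yes _ | ν , _ , fewer = ⊥-elim (n≮0 (<-≤-trans fewer bound))
    saturate (suc n) μ _ bound | yes _ | ν , ν-matching , fewer =
      saturate n ν ν-matching (≤-pred (<-≤-trans fewer bound))

  remove-perfectMatching : ∀ {E k μ} → IsRegularBipartite E R col (suc k) → IsPerfectMatching E R μ →
                           IsRegularBipartite (E ∖ μ) R col k
  remove-perfectMatching {E} {k} {μ} G μ-perfect = record
    { symmetric = λ x∈R y∈R → cong₂ _∧_ (symmetric x∈R y∈R) (cong not (partners-sym x∈R y∈R))
    ; bipartite = λ x∈R y∈R E∖μxy → bipartite x∈R y∈R (∧-conicalˡ _ _ E∖μxy)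
    ; regular   = λ {x} x∈R → sym (suc-injective (begin
        suc k
          ≡⟨ regular x∈R ⟨
        count (R ∩ E x)
          ≡⟨ count-split (R ∩ E x) ⁅ μ x ⁆ ⟩
        count ((R ∩ E x) ∩ ⁅ μ x ⁆) + count ((R ∩ E x) ∩ ∁ ⁅ μ x ⁆)
          ≡⟨ cong₂ _+_ (partner-counted x∈R) (count-cong (λ y → ∧-assoc (R y) _ _)) ⟩
        1 + count (R ∩ (E ∖ μ) x) ∎))
    }
    where
    open IsRegularBipartite G
    open ≡-Reasoning

    partners-sym : ∀ {x y} → x ∈ R → y ∈ R → ⁅ μ x ⁆ y ≡ ⁅ μ y ⁆ x
    partners-sym {x} {y} x∈R y∈R with y ≡? μ x
    ... | inj₁ y≡μx = trans (≡⇒∈-⁅⁆ y≡μx) (sym (≡⇒∈-⁅⁆ (sym (matched-sym E (μ-perfect x∈R) (sym y≡μx)))))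
    ... | inj₂ y≢μx =
      trans (∉-⁅⁆ y≢μx) (sym (∉-⁅⁆ (λ x≡μy → y≢μx (sym (matched-sym E (μ-perfect y∈R) (sym x≡μy))))))

    partner-counted : ∀ {x} → x ∈ R → count ((R ∩ E x) ∩ ⁅ μ x ⁆) ≡ 1
    partner-counted {x} x∈R = let matched μx∈R _ _ Exμx = μ-perfect x∈R in
      trans (count-∩⁅⁆ (R ∩ E x) (μ x)) (cong 𝟙 (cong₂ _∧_ μx∈R Exμx))

  perfectMatching-through : ∀ {E} k → IsRegularBipartite E R col (suc k) →
    ∀ {p q} → p ∈ R → q ∈ R → E p q ≡ true → ∃ λ μ → IsPerfectMatching E R μ × μ p ≡ q
  perfectMatching-through {E} k G {p} {q} p∈R q∈R Epq with regular-bipartite⇒perfectMatching G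
  ... | μ , μ-perfect with μ p ≡? q | k
  ...   | inj₁ μp≡q | _      = μ , μ-perfect , μp≡q
  ...   | inj₂ μp≢q | zero   = ⊥-elim (n≮0 (subst (0 <_) (regular p∈R) (∈⇒count-pos {S = R ∩ (E ∖ μ) p} q∈rest)))
    where
    open IsRegularBipartite (remove-perfectMatching G μ-perfect)
    q∈rest : q ∈ R ∩ (E ∖ μ) p
    q∈rest = cong₂ _∧_ q∈R (cong₂ _∧_ Epq (∈-∁ ⁅ μ p ⁆ (∉-⁅⁆ (μp≢q ∘ sym))))
  ...   | inj₂ μp≢q | suc k′ =
    let ν , ν-perfect , νp≡q = perfectMatching-through k′ (remove-perfectMatching G μ-perfect) p∈R q∈R
                                 (cong₂ _∧_ Epq (∈-∁ ⁅ μ p ⁆ (∉-⁅⁆ (μp≢q ∘ sym))))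
    in ν , perfectMatching-mono (λ _ → ∧-conicalˡ _ _) ν-perfect , νp≡q

  perfectMatching-avoiding : ∀ {E} k → IsRegularBipartite E R col (suc (suc k)) →
    ∀ {p} q → p ∈ R → ∃ λ μ → IsPerfectMatching E R μ × μ p ≢ q
  perfectMatching-avoiding k G {p} q p∈R with regular-bipartite⇒perfectMatching G
  ... | μ , μ-perfect with μ p ≡? q
  ...   | inj₂ μp≢q = μ , μ-perfect , μp≢q
  ...   | inj₁ μp≡q =
    let ν , ν-perfect = regular-bipartite⇒perfectMatching (remove-perfectMatching G μ-perfect)
        νp≢μp = ∉-⁅⁆⁻ (∈-∁⁻ ⁅ μ p ⁆ (∧-conicalʳ _ _ (Matched.edge (ν-perfect p∈R))))
    in ν , perfectMatching-mono (λ _ → ∧-conicalˡ _ _) ν-perfect , (λ νp≡q → νp≢μp (trans νp≡q (sym μp≡q)))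

-- Nice pairs

module _ {m} (E : Fin m → Fin m → Bool) (S : Fin m → Bool) (a b : Fin m) where

  ∈-remaining : ∀ {x} → x ∈ S → x ≢ a → x ≢ b → E x a ≡ false → E x b ≡ false → x ∈ remaining E S a b
  ∈-remaining x∈S x≢a x≢b xa xb =
    cong₂ _∧_ x∈S (cong₂ _∧_ (cong not (∉-⁅⁆ x≢a))
                  (cong₂ _∧_ (cong not (∉-⁅⁆ x≢b)) (cong₂ _∧_ (cong not xa) (cong not xb))))

  ∈-remaining⁻ : ∀ {x} → x ∈ remaining E S a b → x ∈ S × x ≢ a × x ≢ b × E x a ≡ false × E x b ≡ false
  ∈-remaining⁻ {x} h =
    let x∈S , h₁ = ∈-∩⁻ S (∁ ⁅ a ⁆ ∩ ∁ ⁅ b ⁆ ∩ ∁ (λ y → E y a) ∩ ∁ (λ y → E y b)) h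
        x∉a , h₂ = ∈-∩⁻ (∁ ⁅ a ⁆) (∁ ⁅ b ⁆ ∩ ∁ (λ y → E y a) ∩ ∁ (λ y → E y b)) h₁
        x∉b , h₃ = ∈-∩⁻ (∁ ⁅ b ⁆) (∁ (λ y → E y a) ∩ ∁ (λ y → E y b)) h₂
        xa , xb = ∈-∩⁻ (∁ (λ y → E y a)) (∁ (λ y → E y b)) h₃
    in x∈S , ∉-⁅⁆⁻ (∈-∁⁻ ⁅ a ⁆ x∉a) , ∉-⁅⁆⁻ (∈-∁⁻ ⁅ b ⁆ x∉b) , ∈-∁⁻ (λ y → E y a) xa , ∈-∁⁻ (λ y → E y b) xb

  ∉-remaining⁻ : ∀ {x} → x ∉ remaining E S a b → x ∉ S ⊎ x ≡ a ⊎ x ≡ b ⊎ E x a ≡ true ⊎ E x b ≡ true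
  ∉-remaining⁻ {x} x∉ with true-or-false (S x) | x ≡? a | x ≡? b | true-or-false (E x a) | true-or-false (E x b)
  ... | inj₂ x∉S | _        | _        | _        | _        = inj₁ x∉S
  ... | inj₁ _   | inj₁ x≡a | _        | _        | _        = inj₂ (inj₁ x≡a)
  ... | inj₁ _   | inj₂ _   | inj₁ x≡b | _        | _        = inj₂ (inj₂ (inj₁ x≡b))
  ... | inj₁ _   | inj₂ _   | inj₂ _   | inj₁ xa  | _        = inj₂ (inj₂ (inj₂ (inj₁ xa)))
  ... | inj₁ _   | inj₂ _   | inj₂ _   | inj₂ _   | inj₁ xb  = inj₂ (inj₂ (inj₂ (inj₂ xb)))
  ... | inj₁ x∈S | inj₂ x≢a | inj₂ x≢b | inj₂ xa  | inj₂ xb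
      with () ← trans (sym (∈-remaining x∈S x≢a x≢b xa xb)) x∉

nicePairIn-cong : ∀ {m} {E F : Fin m → Fin m → Bool} {S a b} → (∀ x y → E x y ≡ F x y) →
                  NicePairIn E S a b → NicePairIn F S a b
nicePairIn-cong {m} {E} {F} {S} {a} {b} E≗F nice =
  toHasPerfectMatching {E = F} (μ , perfectMatching-mono {E = F} {E} {remaining F S a b} in-F
    (perfectMatching-restrict {R = remaining E S a b} μ-perfect RF⊆RE closed))
  where
  μ : Fin m → Fin m
  μ = proj₁ (fromHasPerfectMatching {E = E} nice)

  μ-perfect : IsPerfectMatching E (remaining E S a b) μ
  μ-perfect = proj₂ (fromHasPerfectMatching {E = E} nice)

  same : ∀ x → remaining E S a b x ≡ remaining F S a b x
  same x = cong₂ (λ p q → S x ∧ not ⌊ x ≟ a ⌋ ∧ not ⌊ x ≟ b ⌋ ∧ not p ∧ not q) (E≗F x a) (E≗F x b)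

  RF⊆RE : remaining F S a b ⊆ remaining E S a b
  RF⊆RE {x} = trans (same x)

  closed : ∀ {x} → x ∈ remaining F S a b → μ x ∈ remaining F S a b
  closed {x} x∈RF = trans (sym (same (μ x))) (Matched.partner∈ (μ-perfect (RF⊆RE x∈RF)))

  in-F : ∀ {x} → x ∈ remaining F S a b → E x (μ x) ≡ true → F x (μ x) ≡ true
  in-F {x} _ Exμx = trans (sym (E≗F x (μ x))) Exμx

-- Two-edge cuts of cubic bipartite graphs

*3≢*3+2 : ∀ p q → p * 3 ≢ q * 3 + 2
*3≢*3+2 p q eq = 0≢2 (begin
  0                  ≡⟨ m*n%n≡0 p 3 ⟨
  p * 3 % 3          ≡⟨ cong (_% 3) (trans eq (+-comm (q * 3) 2)) ⟩
  (2 + q * 3) % 3    ≡⟨ [m+kn]%n≡m%n 2 q 3 ⟩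
  2                  ∎)
  where
  open ≡-Reasoning
  0≢2 : 0 ≢ 2
  0≢2 ()

record TwoCut (G : Graph) (X : Fin (n G) → Bool) (u v w z : Fin (n G)) : Set where
  field
    u∈X      : u ∈ X
    w∈X      : w ∈ X
    v∉X      : v ∉ X
    z∉X      : z ∉ X
    edge-uv  : adj G u v ≡ true
    edge-wz  : adj G w z ≡ true
    distinct : ¬ (u ≡ w × v ≡ z)
    crossing : ∀ {x y} → adj G x y ≡ true → x ∈ X → y ∉ X → (x ≡ u × y ≡ v) ⊎ (x ≡ w × y ≡ z)

module _ {G : Graph} {X : Fin (n G) → Bool} {u v w z : Fin (n G)} where

  fromIsTwoCut : IsTwoCut G X u v w z → TwoCut G X u v w z
  fromIsTwoCut (_ , _ , u∈X , w∈X , v∉X , z∉X , edge-uv , edge-wz , distinct , crossing) =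
    record { u∈X = u∈X ; w∈X = w∈X ; v∉X = v∉X ; z∉X = z∉X ; edge-uv = edge-uv ; edge-wz = edge-wz
           ; distinct = distinct ; crossing = λ {x} {y} → crossing x y }

  swapCut : TwoCut G X u v w z → TwoCut G X w z u v
  swapCut cut = record
    { u∈X = w∈X ; w∈X = u∈X ; v∉X = z∉X ; z∉X = v∉X ; edge-uv = edge-wz ; edge-wz = edge-uv
    ; distinct = λ (w≡u , z≡v) → distinct (sym w≡u , sym z≡v)
    ; crossing = λ xy x∈X y∉X → [ inj₂ , inj₁ ]′ (crossing xy x∈X y∉X)
    }
    where open TwoCut cut

  complementCut : TwoCut G X u v w z → TwoCut G (∁ X) v u z w
  complementCut cut = record
    { u∈X = ∈-∁ X v∉X ; w∈X = ∈-∁ X z∉X ; v∉X = cong not u∈X ; z∉X = cong not w∈X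
    ; edge-uv = trans (Graph.sym G v u) edge-uv ; edge-wz = trans (Graph.sym G z w) edge-wz
    ; distinct = λ (v≡z , u≡w) → distinct (u≡w , v≡z)
    ; crossing = λ {x} {y} xy x∉X y∈X →
        [ (λ (y≡u , x≡v) → inj₁ (x≡v , y≡u)) , (λ (y≡w , x≡z) → inj₂ (x≡z , y≡w)) ]′
        (crossing (trans (Graph.sym G y x) xy) (∉-∁⁻ X y∈X) (∈-∁⁻ X x∉X))
    }
    where open TwoCut cut

sum-tabulate : ∀ {k} (f : Fin k → ℕ) → listSum (tabulate f) ≡ sum f
sum-tabulate {zero}  f = refl
sum-tabulate {suc k} f = cong (f zero +_) (sum-tabulate (f ∘ suc))

deg≡count : ∀ G x → deg G x ≡ count (adj G x)
deg≡count G x = trans (cong listSum (map-tabulate id (𝟙 ∘ adj G x))) (sum-tabulate (𝟙 ∘ adj G x))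

module CubicBipartite (G : Graph) (cubic : Cubic G) (col : Fin (n G) → Bool) (bipartite : IsBipartition G col)
  where

  Crosses : (Fin (n G) → Bool) → (Fin (n G) → Bool) → Set
  Crosses P Q = ∀ {x y} → adj G x y ≡ true → x ∈ P → y ∈ Q

  A→B : Crosses (∁ col) col
  A→B {x} {y} xy x∈A = trans (¬-not (bipartite y x (trans (Graph.sym G y x) xy))) (cong not (∈-∁⁻ col x∈A))

  B→A : Crosses col (∁ col)
  B→A {x} {y} xy x∈B = ∈-∁ col (trans (¬-not (bipartite y x (trans (Graph.sym G y x) xy))) (cong not x∈B))

  degree : ∀ x → count (adj G x) ≡ 3
  degree x = trans (sym (deg≡count G x)) (cubic x)

  colours-≢ : ∀ {x y} → col x ≡ false → col y ≡ true → x ≢ y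
  colours-≢ x∈A y∈B x≡y = true≢false (trans (sym y∈B) (trans (cong col (sym x≡y)) x∈A))

  regular-bipartite : IsRegularBipartite (adj G) (λ _ → true) col 3
  regular-bipartite = record
    { symmetric = λ {x} {y} _ _ → Graph.sym G x y
    ; bipartite = λ {x} {y} _ _ → bipartite x y
    ; regular   = λ {x} _ → degree x
    }

  inner : (Y P : Fin (n G) → Bool) → ℕ
  inner Y P = ∑[ x < n G ] count (λ y → (Y ∩ P) x ∧ (adj G x ∩ Y) y)

  inner-mono : ∀ Y {P Q} → Crosses P Q → inner Y P ≤ inner Y Q
  inner-mono Y {P} {Q} P→Q = begin
    inner Y P
      ≤⟨ ∑-mono-≤ (λ x → ∑-mono-≤ (λ y → 𝟙-mono (flip-edge x y))) ⟩
    ∑[ x < n G ] ∑[ y < n G ] 𝟙 ((Y ∩ Q) y ∧ (adj G y ∩ Y) x)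
      ≡⟨ ∑-comm (λ x y → 𝟙 ((Y ∩ Q) y ∧ (adj G y ∩ Y) x)) ⟩
    inner Y Q ∎
    where
    open ≤-Reasoning
    flip-edge : ∀ x y → (Y ∩ P) x ∧ (adj G x ∩ Y) y ≡ true → (Y ∩ Q) y ∧ (adj G y ∩ Y) x ≡ true
    flip-edge x y h =
      let x∈Y∩P , xy∈ = ∈-∩⁻ (λ _ → (Y ∩ P) x) (adj G x ∩ Y) h
          x∈Y , x∈P = ∈-∩⁻ Y P x∈Y∩P
          xy , y∈Y = ∈-∩⁻ (adj G x) Y xy∈
      in cong₂ _∧_ (cong₂ _∧_ y∈Y (P→Q xy x∈P)) (cong₂ _∧_ (trans (Graph.sym G y x) xy) x∈Y)

  leaving : (Y R : Fin (n G) → Bool) → (Fin (n G) → Fin (n G)) → Fin (n G) → Bool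
  leaving Y R μ = ∁ (R ∩ (Y ∘ μ))

  matching-balance : ∀ {Y R μ} → count (Y ∩ ∁ col) ≡ count (Y ∩ col) → IsPerfectMatching (adj G) R μ →
    count ((Y ∩ ∁ col) ∩ leaving Y R μ) ≡ count ((Y ∩ col) ∩ leaving Y R μ)
  matching-balance {Y} {R} {μ} balanced μ-perfect =
    +-cancelˡ-≡ (count (within (∁ col))) (count (leaves (∁ col))) (count (leaves col)) (begin
      count (within (∁ col)) + count (leaves (∁ col))  ≡⟨ count-split (Y ∩ ∁ col) (R ∩ (Y ∘ μ)) ⟨
      count (Y ∩ ∁ col)                                ≡⟨ balanced ⟩
      count (Y ∩ col)                                  ≡⟨ count-split (Y ∩ col) (R ∩ (Y ∘ μ)) ⟩
      count (within col) + count (leaves col)          ≡⟨ cong (_+ count (leaves col)) within-balanced ⟨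
      count (within (∁ col)) + count (leaves col)      ∎)
    where
    open ≡-Reasoning
    within leaves : (Fin (n G) → Bool) → Fin (n G) → Bool
    within P = (Y ∩ P) ∩ (R ∩ (Y ∘ μ))
    leaves P = (Y ∩ P) ∩ leaving Y R μ

    within-mono : ∀ {P Q} → Crosses P Q → count (within P) ≤ count (within Q)
    within-mono {P} {Q} P→Q = count-injection {S = within P} μ μ λ {x} h →
      let x∈Y∩P , x∈R∩Yμ = ∈-∩⁻ (Y ∩ P) (R ∩ (Y ∘ μ)) h
          x∈Y , x∈P = ∈-∩⁻ Y P x∈Y∩P
          x∈R , μx∈Y = ∈-∩⁻ R (Y ∘ μ) x∈R∩Yμ
          matched μx∈R _ μμx≡x xμx = μ-perfect x∈R
      in cong₂ _∧_ (cong₂ _∧_ μx∈Y (P→Q xμx x∈P)) (cong₂ _∧_ μx∈R (trans (cong Y μμx≡x) x∈Y)) , μμx≡x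

    within-balanced : count (within (∁ col)) ≡ count (within col)
    within-balanced = ≤-antisym (within-mono A→B) (within-mono B→A)

  module Cut {X u v w z} (cut : TwoCut G X u v w z) where
    open TwoCut cut

    boundary-degree : ∀ {x} → x ∈ X → count (adj G x ∩ ∁ X) ≡ 𝟙 (⁅ u ⁆ x) + 𝟙 (⁅ w ⁆ x)
    boundary-degree {x} x∈X = begin
      count (adj G x ∩ ∁ X)         ≡⟨ count-≐ {S = adj G x ∩ ∁ X} {via-uv ∪ via-wz} leaves-by-cut cut-leaves ⟩
      count (via-uv ∪ via-wz)       ≡⟨ count-∪-disjoint via-uv via-wz disjoint ⟩
      count via-uv + count via-wz   ≡⟨ cong₂ _+_ (count-∩⁅⁆ (λ _ → ⁅ u ⁆ x) v) (count-∩⁅⁆ (λ _ → ⁅ w ⁆ x) z) ⟩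
      𝟙 (⁅ u ⁆ x) + 𝟙 (⁅ w ⁆ x)     ∎
      where
      open ≡-Reasoning
      via-uv via-wz : Fin (n G) → Bool
      via-uv y = ⁅ u ⁆ x ∧ ⁅ v ⁆ y
      via-wz y = ⁅ w ⁆ x ∧ ⁅ z ⁆ y

      leaves-by-cut : adj G x ∩ ∁ X ⊆ via-uv ∪ via-wz
      leaves-by-cut {y} h =
        let xy , y∈∁X = ∈-∩⁻ (adj G x) (∁ X) h in
        [ (λ (x≡u , y≡v) → ∈-∪ˡ via-uv via-wz (cong₂ _∧_ (≡⇒∈-⁅⁆ x≡u) (≡⇒∈-⁅⁆ y≡v)))
        , (λ (x≡w , y≡z) → ∈-∪ʳ via-uv via-wz (cong₂ _∧_ (≡⇒∈-⁅⁆ x≡w) (≡⇒∈-⁅⁆ y≡z)))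
        ]′ (crossing xy x∈X (∈-∁⁻ X y∈∁X))

      cut-leaves : via-uv ∪ via-wz ⊆ adj G x ∩ ∁ X
      cut-leaves {y} h with ∈-∪⁻ via-uv via-wz h
      ... | inj₁ h′ with ∈-∩⁻ (λ _ → ⁅ u ⁆ x) ⁅ v ⁆ h′
      ...   | x∈⁅u⁆ , y∈⁅v⁆ rewrite ∈-⁅⁆⁻ x∈⁅u⁆ | ∈-⁅⁆⁻ y∈⁅v⁆ = cong₂ _∧_ edge-uv (∈-∁ X v∉X)
      cut-leaves {y} h | inj₂ h′ with ∈-∩⁻ (λ _ → ⁅ w ⁆ x) ⁅ z ⁆ h′
      ...   | x∈⁅w⁆ , y∈⁅z⁆ rewrite ∈-⁅⁆⁻ x∈⁅w⁆ | ∈-⁅⁆⁻ y∈⁅z⁆ = cong₂ _∧_ edge-wz (∈-∁ X z∉X)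

      disjoint : ∀ {y} → y ∈ via-uv → y ∉ via-wz
      disjoint {y} h = ¬-not λ h′ →
        let x∈⁅u⁆ , y∈⁅v⁆ = ∈-∩⁻ (λ _ → ⁅ u ⁆ x) ⁅ v ⁆ h
            x∈⁅w⁆ , y∈⁅z⁆ = ∈-∩⁻ (λ _ → ⁅ w ⁆ x) ⁅ z ⁆ h′
        in distinct (trans (sym (∈-⁅⁆⁻ x∈⁅u⁆)) (∈-⁅⁆⁻ x∈⁅w⁆) , trans (sym (∈-⁅⁆⁻ y∈⁅v⁆)) (∈-⁅⁆⁻ y∈⁅z⁆))

    degree-inside : ∀ {x} → x ∈ X → count (adj G x ∩ X) + (𝟙 (⁅ u ⁆ x) + 𝟙 (⁅ w ⁆ x)) ≡ 3
    degree-inside {x} x∈X =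
      trans (cong (count (adj G x ∩ X) +_) (sym (boundary-degree x∈X)))
            (trans (sym (count-split (adj G x) X)) (degree x))

    handshake : ∀ P → count (X ∩ P) * 3 ≡ inner X P + (𝟙 (P u) + 𝟙 (P w))
    handshake P = begin
      count (X ∩ P) * 3
        ≡⟨ ∑-count-regular (X ∩ P) (adj G) (λ {x} _ → degree x) ⟨
      ∑[ x < n G ] count (λ y → (X ∩ P) x ∧ adj G x y)
        ≡⟨ sum-cong-≗ split ⟩
      ∑[ x < n G ] (count (λ y → (X ∩ P) x ∧ (adj G x ∩ X) y) + (at u x + at w x))
        ≡⟨ ∑-distrib-+ (λ x → count (λ y → (X ∩ P) x ∧ (adj G x ∩ X) y)) _ ⟩
      inner X P + ∑[ x < n G ] (at u x + at w x)
        ≡⟨ cong (inner X P +_) (∑-distrib-+ (at u) (at w)) ⟩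
      inner X P + (count ((X ∩ P) ∩ ⁅ u ⁆) + count ((X ∩ P) ∩ ⁅ w ⁆))
        ≡⟨ cong (inner X P +_) (cong₂ _+_ (count-∩⁅⁆ (X ∩ P) u) (count-∩⁅⁆ (X ∩ P) w)) ⟩
      inner X P + (𝟙 (X u ∧ P u) + 𝟙 (X w ∧ P w))
        ≡⟨ cong₂ (λ a b → inner X P + (𝟙 (a ∧ P u) + 𝟙 (b ∧ P w))) u∈X w∈X ⟩
      inner X P + (𝟙 (P u) + 𝟙 (P w)) ∎
      where
      open ≡-Reasoning
      at : Fin (n G) → Fin (n G) → ℕ
      at c x = 𝟙 ((X ∩ P) x ∧ ⁅ c ⁆ x)

      split : ∀ x → count (λ y → (X ∩ P) x ∧ adj G x y)
                  ≡ count (λ y → (X ∩ P) x ∧ (adj G x ∩ X) y) + (at u x + at w x)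
      split x with (X ∩ P) x in x∈X∩P
      ... | true  = trans (count-split (adj G x) X)
                      (cong (count (adj G x ∩ X) +_) (boundary-degree (proj₁ (∈-∩⁻ X P x∈X∩P))))
      ... | false = sym (+-identityʳ _)

    private
      colour-count : count (X ∩ ∁ col) * 3 + (𝟙 (col u) + 𝟙 (col w))
                   ≡ count (X ∩ col) * 3 + (𝟙 (not (col u)) + 𝟙 (not (col w)))
      colour-count = begin
        count (X ∩ ∁ col) * 3 + b₁  ≡⟨ cong (_+ b₁) (handshake (∁ col)) ⟩
        inner X (∁ col) + b₀ + b₁   ≡⟨ cong (λ i → i + b₀ + b₁) (≤-antisym (inner-mono X A→B) (inner-mono X B→A)) ⟩
        inner X col + b₀ + b₁       ≡⟨ +-assoc (inner X col) b₀ b₁ ⟩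
        inner X col + (b₀ + b₁)     ≡⟨ cong (inner X col +_) (+-comm b₀ b₁) ⟩
        inner X col + (b₁ + b₀)     ≡⟨ +-assoc (inner X col) b₁ b₀ ⟨
        inner X col + b₁ + b₀       ≡⟨ cong (_+ b₀) (handshake col) ⟨
        count (X ∩ col) * 3 + b₀    ∎
        where
        open ≡-Reasoning
        b₀ b₁ : ℕ
        b₀ = 𝟙 (not (col u)) + 𝟙 (not (col w))
        b₁ = 𝟙 (col u) + 𝟙 (col w)

    -- Otherwise 3|X ∩ A| and 3|X ∩ B| would differ by 2.
    ends-coloured-differently : col u ≢ col w
    ends-coloured-differently same with col u | col w | colour-count
    ... | true  | true  | eq = *3≢*3+2 (count (X ∩ col)) (count (X ∩ ∁ col)) (sym (trans eq (+-identityʳ _)))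
    ... | false | false | eq = *3≢*3+2 (count (X ∩ ∁ col)) (count (X ∩ col)) (trans (sym (+-identityʳ _)) eq)

    other-end-colour : ∀ {c} → col u ≡ c → col w ≡ not c
    other-end-colour u-colour = trans (¬-not (ends-coloured-differently ∘ sym)) (cong not u-colour)

    balanced : count (X ∩ ∁ col) ≡ count (X ∩ col)
    balanced with col u | col w | colour-count | ends-coloured-differently
    ... | true  | true  | _  | differ = ⊥-elim (differ refl)
    ... | false | false | _  | differ = ⊥-elim (differ refl)
    ... | true  | false | eq | _ = *-cancelʳ-≡ _ _ 3 (+-cancelʳ-≡ 1 _ _ eq)
    ... | false | true  | eq | _ = *-cancelʳ-≡ _ _ 3 (+-cancelʳ-≡ 1 _ _ eq)

  -- The B-vertices of X not matched inside X include the neighbours of a in X, while the A-vertices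
  -- not matched inside X lie among a and u; matching-balance equates the two counts.
  no-nicePair-across-oriented : ∀ {X u v w z} → TwoCut G X u v w z → col u ≡ false →
    ∀ {a b} → col a ≡ false → a ∈ X → b ∉ X → ¬ NicePair G a b
  no-nicePair-across-oriented {X} {u} {v} {w} {z} cut u∈A {a} {b} a∈A a∈X b∉X nice = <-irrefl refl (begin-strict
    2
      <⟨ n<1+n 2 ⟩
    3
      ≡⟨ degree-inside a∈X ⟨
    count (adj G a ∩ X) + (𝟙 (⁅ u ⁆ a) + 𝟙 (⁅ w ⁆ a))
      ≡⟨ cong (λ t → count (adj G a ∩ X) + (𝟙 (⁅ u ⁆ a) + 𝟙 t)) (∉-⁅⁆ (colours-≢ a∈A w∈B)) ⟩
    count (adj G a ∩ X) + (𝟙 (⁅ u ⁆ a) + 0)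
      ≡⟨ cong (count (adj G a ∩ X) +_) (+-identityʳ _) ⟩
    count (adj G a ∩ X) + 𝟙 (⁅ u ⁆ a)
      ≤⟨ +-monoˡ-≤ (𝟙 (⁅ u ⁆ a)) (count-mono {S = adj G a ∩ X} neighbours-leave) ⟩
    count ((X ∩ col) ∩ L) + 𝟙 (⁅ u ⁆ a)
      ≡⟨ cong (_+ 𝟙 (⁅ u ⁆ a)) (matching-balance {X} {RG} balanced μ-perfect) ⟨
    count ((X ∩ ∁ col) ∩ L) + 𝟙 (⁅ u ⁆ a)
      ≤⟨ +-monoˡ-≤ (𝟙 (⁅ u ⁆ a)) (count-mono {S = (X ∩ ∁ col) ∩ L} leavers) ⟩
    count (⁅ a ⁆ ∪ ⁅ u ⁆) + 𝟙 (⁅ u ⁆ a)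
      ≡⟨ count-pair a u ⟩
    2 ∎)
    where
    open ≤-Reasoning
    open TwoCut cut
    open Cut cut

    RG : Fin (n G) → Bool
    RG = remaining (adj G) (λ _ → true) a b

    matching : ∃ (IsPerfectMatching (adj G) RG)
    matching = fromHasPerfectMatching {E = adj G} nice

    μ : Fin (n G) → Fin (n G)
    μ = proj₁ matching

    μ-perfect : IsPerfectMatching (adj G) RG μ
    μ-perfect = proj₂ matching

    L : Fin (n G) → Bool
    L = leaving X RG μ

    w∈B : col w ≡ true
    w∈B = other-end-colour u∈A

    neighbours-leave : adj G a ∩ X ⊆ (X ∩ col) ∩ L
    neighbours-leave {y} h =
      let ay , y∈X = ∈-∩⁻ (adj G a) X h
          y∉RG : y ∉ RG
          y∉RG = ¬-not λ y∈RG → let _ , _ , _ , ya , _ = ∈-remaining⁻ (adj G) (λ _ → true) a b y∈RG in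
                   true≢false (trans (sym (trans (Graph.sym G y a) ay)) ya)
      in cong₂ _∧_ (cong₂ _∧_ y∈X (A→B ay (∈-∁ col a∈A))) (∈-∁ (RG ∩ (X ∘ μ)) (cong (_∧ X (μ y)) y∉RG))

    leavers : (X ∩ ∁ col) ∩ L ⊆ ⁅ a ⁆ ∪ ⁅ u ⁆
    leavers {x} h =
      let x∈X∩A , x-leaves = ∈-∩⁻ (X ∩ ∁ col) L h
          x∈X , x∈A = ∈-∩⁻ X (∁ col) x∈X∩A
          x≢w = colours-≢ (∈-∁⁻ col x∈A) w∈B
          cut-at-u : ∀ {y} → adj G x y ≡ true → y ∉ X → x ∈ ⁅ a ⁆ ∪ ⁅ u ⁆
          cut-at-u xy y∉X =
            ∈-∪ʳ ⁅ a ⁆ ⁅ u ⁆ (≡⇒∈-⁅⁆ ([ proj₁ , ⊥-elim ∘ x≢w ∘ proj₁ ]′ (crossing xy x∈X y∉X)))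
          μx∉X : x ∈ RG → μ x ∉ X
          μx∉X x∈RG = trans (cong (_∧ X (μ x)) (sym x∈RG)) (∈-∁⁻ (RG ∩ (X ∘ μ)) x-leaves)
      in [ (λ x∈RG → cut-at-u (Matched.edge (μ-perfect x∈RG)) (μx∉X x∈RG))
         , (λ x∉RG → [ (λ ()) , [ ∈-∪ˡ ⁅ a ⁆ ⁅ u ⁆ ∘ ≡⇒∈-⁅⁆ , [ ⊥-elim ∘ ∈∉⇒≢ x∈X b∉X
                     , [ (λ xa → ⊥-elim (bipartite x a xa (trans (∈-∁⁻ col x∈A) (sym a∈A))))
                       , (λ xb → cut-at-u xb b∉X) ]′ ]′ ]′ ]′
                     (∉-remaining⁻ (adj G) (λ _ → true) a b x∉RG))
         ]′ (true-or-false (RG x))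

  module Reduction {X u v w z} (cut : TwoCut G X u v w z) (u∈A : col u ≡ false) (uw∉E : adj G u w ≡ false)
                   {a b} (a∈A : col a ≡ false) (b∈B : col b ≡ true) (a∈X : a ∈ X) (b∈X : b ∈ X) where
    open TwoCut cut
    open Cut cut

    H : Fin (n G) → Fin (n G) → Bool
    H = adjPlus G u w

    RG RH : Fin (n G) → Bool
    RG = remaining (adj G) (λ _ → true) a b
    RH = remaining H X a b

    w∈B : col w ≡ true
    w∈B = other-end-colour u∈A

    v∈B : col v ≡ true
    v∈B = A→B edge-uv (∈-∁ col u∈A)

    z∈A : col z ≡ false
    z∈A = ∈-∁⁻ col (B→A edge-wz w∈B)

    H-⊇ : ∀ {x y} → adj G x y ≡ true → H x y ≡ true
    H-⊇ {x} {y} xy = ∈-∪ˡ (adj G x) (λ y → ⁅ u ⁆ x ∧ ⁅ w ⁆ y ∨ ⁅ w ⁆ x ∧ ⁅ u ⁆ y) xy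

    H-⊆ : ∀ {x y} → H x y ≡ true → adj G x y ≡ true ⊎ (x ≡ u × y ≡ w) ⊎ (x ≡ w × y ≡ u)
    H-⊆ {x} {y} h with ∈-∪⁻ (adj G x) (λ y → ⁅ u ⁆ x ∧ ⁅ w ⁆ y ∨ ⁅ w ⁆ x ∧ ⁅ u ⁆ y) h
    ... | inj₁ xy = inj₁ xy
    ... | inj₂ h′ with ∈-∪⁻ (λ y → ⁅ u ⁆ x ∧ ⁅ w ⁆ y) (λ y → ⁅ w ⁆ x ∧ ⁅ u ⁆ y) h′
    ...   | inj₁ uw = let x∈u , y∈w = ∈-∩⁻ (λ _ → ⁅ u ⁆ x) ⁅ w ⁆ uw in inj₂ (inj₁ (∈-⁅⁆⁻ x∈u , ∈-⁅⁆⁻ y∈w))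
    ...   | inj₂ wu = let x∈w , y∈u = ∈-∩⁻ (λ _ → ⁅ w ⁆ x) ⁅ u ⁆ wu in inj₂ (inj₂ (∈-⁅⁆⁻ x∈w , ∈-⁅⁆⁻ y∈u))

    H-uw : H u w ≡ true
    H-uw = ∈-∪ʳ (adj G u) (λ y → ⁅ u ⁆ u ∧ ⁅ w ⁆ y ∨ ⁅ w ⁆ u ∧ ⁅ u ⁆ y)
             (∈-∪ˡ (λ y → ⁅ u ⁆ u ∧ ⁅ w ⁆ y) (λ y → ⁅ w ⁆ u ∧ ⁅ u ⁆ y) (cong₂ _∧_ (∈-⁅⁆ u) (∈-⁅⁆ w)))

    H-wu : H w u ≡ true
    H-wu = ∈-∪ʳ (adj G w) (λ y → ⁅ u ⁆ w ∧ ⁅ w ⁆ y ∨ ⁅ w ⁆ w ∧ ⁅ u ⁆ y)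
             (∈-∪ʳ (λ y → ⁅ u ⁆ w ∧ ⁅ w ⁆ y) (λ y → ⁅ w ⁆ w ∧ ⁅ u ⁆ y) (cong₂ _∧_ (∈-⁅⁆ w) (∈-⁅⁆ u)))

    edge-vu : adj G v u ≡ true
    edge-vu = trans (Graph.sym G v u) edge-uv

    edge-zw : adj G z w ≡ true
    edge-zw = trans (Graph.sym G z w) edge-wz

    no-H-edge : ∀ {x y} → adj G x y ≡ false → ¬ (x ≡ u × y ≡ w) → ¬ (x ≡ w × y ≡ u) → H x y ≡ false
    no-H-edge xy≢ not-uw not-wu =
      ¬-not λ Hxy → [ (λ xy → true≢false (trans (sym xy) xy≢)) , [ not-uw , not-wu ]′ ]′ (H-⊆ Hxy)

    ∈-RH⁻ : ∀ {x} → x ∈ RH → x ∈ X × x ∈ RG × (a ≡ u → x ≢ w) × (b ≡ w → x ≢ u)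
    ∈-RH⁻ {x} x∈RH =
      let x∈X , x≢a , x≢b , Hxa , Hxb = ∈-remaining⁻ H X a b x∈RH
          no-edge : ∀ {y} → H x y ≡ false → adj G x y ≡ false
          no-edge Hxy = ¬-not λ xy → true≢false (trans (sym (H-⊇ xy)) Hxy)
      in x∈X , ∈-remaining (adj G) (λ _ → true) a b refl x≢a x≢b (no-edge Hxa) (no-edge Hxb)
         , (λ a≡u x≡w → true≢false (trans (sym H-wu) (subst₂ (λ p q → H p q ≡ false) x≡w a≡u Hxa)))
         , (λ b≡w x≡u → true≢false (trans (sym H-uw) (subst₂ (λ p q → H p q ≡ false) x≡u b≡w Hxb)))

    RH⊆RG : RH ⊆ RG
    RH⊆RG = proj₁ ∘ proj₂ ∘ ∈-RH⁻

    ∈-RH : ∀ {x} → x ∈ X → x ∈ RG → (a ≡ u → x ≢ w) → (b ≡ w → x ≢ u) → x ∈ RH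
    ∈-RH {x} x∈X x∈RG c₁ c₂ =
      let _ , x≢a , x≢b , xa , xb = ∈-remaining⁻ (adj G) (λ _ → true) a b x∈RG
      in ∈-remaining H X a b x∈X x≢a x≢b
           (no-H-edge xa (λ (_ , a≡w) → colours-≢ a∈A w∈B a≡w) (λ (x≡w , a≡u) → c₁ a≡u x≡w))
           (no-H-edge xb (λ (x≡u , b≡w) → c₂ b≡w x≡u) (λ (_ , b≡u) → colours-≢ u∈A b∈B (sym b≡u)))

    ∉RH-inside : ∀ {x} → x ∈ X → x ∈ RG → x ∉ RH → (a ≡ u × x ≡ w) ⊎ (b ≡ w × x ≡ u)
    ∉RH-inside {x} x∈X x∈RG x∉RH with both-or-not (a ≡? u) (x ≡? w) | both-or-not (b ≡? w) (x ≡? u)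
    ... | inj₁ p  | _       = inj₁ p
    ... | inj₂ _  | inj₁ q  = inj₂ q
    ... | inj₂ c₁ | inj₂ c₂ = ⊥-elim (true≢false (trans (sym (∈-RH x∈X x∈RG c₁ c₂)) x∉RH))

    ∈-RG-outside : ∀ {x} → x ∉ X → (a ≡ u → x ≢ v) → (b ≡ w → x ≢ z) → x ∈ RG
    ∈-RG-outside {x} x∉X c₁ c₂ = ∈-remaining (adj G) (λ _ → true) a b refl
      (λ x≡a → ∈∉⇒≢ a∈X x∉X (sym x≡a)) (λ x≡b → ∈∉⇒≢ b∈X x∉X (sym x≡b))
      (¬-not λ xa → [ (λ (a≡u , x≡v) → c₁ a≡u x≡v) , (λ (a≡w , _) → colours-≢ a∈A w∈B a≡w) ]′
                       (crossing (trans (Graph.sym G a x) xa) a∈X x∉X))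
      (¬-not λ xb → [ (λ (b≡u , _) → colours-≢ u∈A b∈B (sym b≡u)) , (λ (b≡w , x≡z) → c₂ b≡w x≡z) ]′
                       (crossing (trans (Graph.sym G b x) xb) b∈X x∉X))

    ∉RG-outside : ∀ {x} → x ∉ X → x ∉ RG → (a ≡ u × x ≡ v) ⊎ (b ≡ w × x ≡ z)
    ∉RG-outside {x} x∉X x∉RG with both-or-not (a ≡? u) (x ≡? v) | both-or-not (b ≡? w) (x ≡? z)
    ... | inj₁ p  | _       = inj₁ p
    ... | inj₂ _  | inj₁ q  = inj₂ q
    ... | inj₂ c₁ | inj₂ c₂ = ⊥-elim (true≢false (trans (sym (∈-RG-outside x∉X c₁ c₂)) x∉RG))

    ∈-RG⁻ : ∀ {x} → x ∈ RG → (a ≡ u → x ≢ v) × (b ≡ w → x ≢ z)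
    ∈-RG⁻ {x} x∈RG =
      let _ , _ , _ , xa , xb = ∈-remaining⁻ (adj G) (λ _ → true) a b x∈RG
      in (λ a≡u x≡v → true≢false (trans (sym edge-vu) (subst₂ (λ p q → adj G p q ≡ false) x≡v a≡u xa)))
         , (λ b≡w x≡z → true≢false (trans (sym edge-zw) (subst₂ (λ p q → adj G p q ≡ false) x≡z b≡w xb)))

    module Forward {μ} (μ-perfect : IsPerfectMatching (adj G) RG μ) where

      L : Fin (n G) → Bool
      L = leaving (∁ X) RG μ

      balance : count ((∁ X ∩ ∁ col) ∩ L) ≡ count ((∁ X ∩ col) ∩ L)
      balance = matching-balance {∁ X} {RG} (Cut.balanced (complementCut cut)) μ-perfect

      ∈-L : ∀ {x} → x ∉ RG ⊎ (x ∈ RG × μ x ∈ X) → x ∈ L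
      ∈-L {x} (inj₁ x∉RG) = ∈-∁ (RG ∩ (∁ X ∘ μ)) (cong (_∧ not (X (μ x))) x∉RG)
      ∈-L (inj₂ (x∈RG , μx∈X)) = ∈-∁ (RG ∩ (∁ X ∘ μ)) (cong₂ _∧_ x∈RG (cong not μx∈X))

      ∈-L⁻ : ∀ {x} → x ∈ L → x ∉ RG ⊎ (x ∈ RG × μ x ∈ X)
      ∈-L⁻ {x} x∈L with true-or-false (RG x)
      ... | inj₂ x∉RG = inj₁ x∉RG
      ... | inj₁ x∈RG =
        inj₂ (x∈RG , ∉-∁⁻ X (trans (cong (_∧ not (X (μ x))) (sym x∈RG)) (∈-∁⁻ (RG ∩ (∁ X ∘ μ)) x∈L)))

      edge-from-partner : ∀ {x} → x ∈ RG → adj G (μ x) x ≡ true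
      edge-from-partner {x} x∈RG = trans (Graph.sym G (μ x) x) (Matched.edge (μ-perfect x∈RG))

      V-leaves Z-leaves : Set
      V-leaves = a ≡ u ⊎ (v ∈ RG × μ v ≡ u)
      Z-leaves = b ≡ w ⊎ (z ∈ RG × μ z ≡ w)

      v-leaves : V-leaves → v ∈ (∁ X ∩ col) ∩ L
      v-leaves h = cong₂ _∧_ (cong₂ _∧_ (∈-∁ X v∉X) v∈B)
        (∈-L ([ v∉RG , (λ (v∈RG , μv≡u) → inj₂ (v∈RG , subst (_∈ X) (sym μv≡u) u∈X)) ]′ h))
        where
        v∉RG : a ≡ u → v ∉ RG ⊎ (v ∈ RG × μ v ∈ X)
        v∉RG a≡u = inj₁ (¬-not λ v∈RG → proj₁ (∈-RG⁻ v∈RG) a≡u refl)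

      z-leaves : Z-leaves → z ∈ (∁ X ∩ ∁ col) ∩ L
      z-leaves h = cong₂ _∧_ (cong₂ _∧_ (∈-∁ X z∉X) (∈-∁ col z∈A))
        (∈-L ([ z∉RG , (λ (z∈RG , μz≡w) → inj₂ (z∈RG , subst (_∈ X) (sym μz≡w) w∈X)) ]′ h))
        where
        z∉RG : b ≡ w → z ∉ RG ⊎ (z ∈ RG × μ z ∈ X)
        z∉RG b≡w = inj₁ (¬-not λ z∈RG → proj₂ (∈-RG⁻ z∈RG) b≡w refl)

      v-leaves⁻ : ∀ {x} → x ∈ (∁ X ∩ col) ∩ L → V-leaves
      v-leaves⁻ {x} h =
        let x∈∁X∩B , x∈L = ∈-∩⁻ (∁ X ∩ col) L h
            x∈∁X , x∈B = ∈-∩⁻ (∁ X) col x∈∁X∩B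
            z≢x = colours-≢ z∈A x∈B
        in [ [ inj₁ ∘ proj₁ , ⊥-elim ∘ z≢x ∘ sym ∘ proj₂ ]′ ∘ ∉RG-outside (∈-∁⁻ X x∈∁X)
           , (λ (x∈RG , μx∈X) →
               [ (λ (μx≡u , x≡v) → inj₂ (subst (_∈ RG) x≡v x∈RG , subst (λ y → μ y ≡ u) x≡v μx≡u))
               , ⊥-elim ∘ z≢x ∘ sym ∘ proj₂ ]′
               (crossing (edge-from-partner x∈RG) μx∈X (∈-∁⁻ X x∈∁X))) ]′
           (∈-L⁻ x∈L)

      z-leaves⁻ : ∀ {x} → x ∈ (∁ X ∩ ∁ col) ∩ L → Z-leaves
      z-leaves⁻ {x} h =
        let x∈∁X∩A , x∈L = ∈-∩⁻ (∁ X ∩ ∁ col) L h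
            x∈∁X , x∈A = ∈-∩⁻ (∁ X) (∁ col) x∈∁X∩A
            x≢v = colours-≢ (∈-∁⁻ col x∈A) v∈B
        in [ [ ⊥-elim ∘ x≢v ∘ proj₂ , inj₁ ∘ proj₁ ]′ ∘ ∉RG-outside (∈-∁⁻ X x∈∁X)
           , (λ (x∈RG , μx∈X) →
               [ ⊥-elim ∘ x≢v ∘ proj₂
               , (λ (μx≡w , x≡z) → inj₂ (subst (_∈ RG) x≡z x∈RG , subst (λ y → μ y ≡ w) x≡z μx≡w)) ]′
               (crossing (edge-from-partner x∈RG) μx∈X (∈-∁⁻ X x∈∁X))) ]′
           (∈-L⁻ x∈L)

      -- In the balanced complement of X only v (a B-vertex) and z (an A-vertex) can be left unmatched inside.
      v⇒z : V-leaves → Z-leaves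
      v⇒z h = z-leaves⁻ (proj₂ (count-≡-nonempty {S = (∁ X ∩ col) ∩ L} (sym balance) (v-leaves h)))

      z⇒v : Z-leaves → V-leaves
      z⇒v h = v-leaves⁻ (proj₂ (count-≡-nonempty {S = (∁ X ∩ ∁ col) ∩ L} balance (z-leaves h)))

      private
        RelinkCase : Set
        RelinkCase = a ≢ u × b ≢ w × u ∈ RG × μ u ≡ v

        crosses-at : ∀ {x} → x ∈ X → x ∈ RG → μ x ∉ X → (x ≡ u × μ x ≡ v) ⊎ (x ≡ w × μ x ≡ z)
        crosses-at x∈X x∈RG μx∉X = crossing (Matched.edge (μ-perfect x∈RG)) x∈X μx∉X

      stay : ¬ RelinkCase → IsPerfectMatching H RH μ
      stay no-relink = perfectMatching-mono (λ _ → H-⊇) (perfectMatching-restrict μ-perfect RH⊆RG closed)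
        where
        u-stays : ¬ (u ∈ RH × μ u ≡ v)
        u-stays (u∈RH , μu≡v) =
          let _ , u∈RG , _ , c₂ = ∈-RH⁻ u∈RH
              _ , u≢a , _ = ∈-remaining⁻ (adj G) (λ _ → true) a b u∈RG
          in no-relink (u≢a ∘ sym , (λ b≡w → c₂ b≡w refl) , u∈RG , μu≡v)

        w-stays : ¬ (w ∈ RH × μ w ≡ z)
        w-stays (w∈RH , μw≡z) =
          let _ , w∈RG , c₁ , _ = ∈-RH⁻ w∈RH
              _ , _ , w≢b , _ = ∈-remaining⁻ (adj G) (λ _ → true) a b w∈RG
              w-matched = μ-perfect w∈RG
              z∈RG = subst (_∈ RG) μw≡z (Matched.partner∈ w-matched)
          in [ (λ a≡u → c₁ a≡u refl)
             , (λ (v∈RG , μv≡u) → no-relink ((λ a≡u → c₁ a≡u refl) , w≢b ∘ sym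
                                            , subst (_∈ RG) μv≡u (Matched.partner∈ (μ-perfect v∈RG))
                                            , matched-sym (adj G) (μ-perfect v∈RG) μv≡u)) ]′
             (z⇒v (inj₂ (z∈RG , matched-sym (adj G) w-matched μw≡z)))

        w-partner : a ≡ u → w ∈ RG → μ w ≡ z
        w-partner a≡u w∈RG =
          [ (λ b≡w → ⊥-elim (proj₁ (proj₂ (proj₂ (∈-remaining⁻ (adj G) (λ _ → true) a b w∈RG))) (sym b≡w)))
          , (λ (z∈RG , μz≡w) → matched-sym (adj G) (μ-perfect z∈RG) μz≡w) ]′
          (v⇒z (inj₁ a≡u))

        u-partner : b ≡ w → u ∈ RG → μ u ≡ v
        u-partner b≡w u∈RG =
          [ (λ a≡u → ⊥-elim (proj₁ (proj₂ (∈-remaining⁻ (adj G) (λ _ → true) a b u∈RG)) (sym a≡u)))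
          , (λ (v∈RG , μv≡u) → matched-sym (adj G) (μ-perfect v∈RG) μv≡u) ]′
          (z⇒v (inj₁ b≡w))

        closed : ∀ {x} → x ∈ RH → μ x ∈ RH
        closed {x} x∈RH =
          let x∈X , x∈RG , _ = ∈-RH⁻ x∈RH
              μx∈RG = Matched.partner∈ (μ-perfect x∈RG)
              μx∈X : μ x ∈ X
              μx∈X = ¬-not λ μx∉X →
                [ (λ (x≡u , μx≡v) → u-stays (subst (_∈ RH) x≡u x∈RH , subst (λ y → μ y ≡ v) x≡u μx≡v))
                , (λ (x≡w , μx≡z) → w-stays (subst (_∈ RH) x≡w x∈RH , subst (λ y → μ y ≡ z) x≡w μx≡z)) ]′
                (crosses-at x∈X x∈RG μx∉X)
              back : ∀ {y y′} → μ x ≡ y → μ y ≡ y′ → y′ ∉ X → ⊥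
              back μx≡y μy≡y′ y′∉X = ∈∉⇒≢ x∈X y′∉X (trans (sym (matched-sym (adj G) (μ-perfect x∈RG) μx≡y)) μy≡y′)
          in ∈-RH μx∈X μx∈RG
               (λ a≡u μx≡w → back μx≡w (w-partner a≡u (subst (_∈ RG) μx≡w μx∈RG)) z∉X)
               (λ b≡w μx≡u → back μx≡u (u-partner b≡w (subst (_∈ RG) μx≡u μx∈RG)) v∉X)

      relink : RelinkCase → ∃ (IsPerfectMatching H RH)
      relink (a≢u , b≢w , u∈RG , μu≡v) =
        glue C μ (link u w id) , perfectMatching-patch C μ-in-H (pair-perfectMatching u≢w H-uw H-wu) inside outside
        where
        C : Fin (n G) → Bool
        C = ∁ (⁅ u ⁆ ∪ ⁅ w ⁆)

        u≢w : u ≢ w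
        u≢w = colours-≢ u∈A w∈B

        μ-in-H : IsPerfectMatching H RG μ
        μ-in-H = perfectMatching-mono (λ _ → H-⊇) μ-perfect

        v∈RG : v ∈ RG
        v∈RG = subst (_∈ RG) μu≡v (Matched.partner∈ (μ-perfect u∈RG))

        z-leaves-to-w : z ∈ RG × μ z ≡ w
        z-leaves-to-w = [ ⊥-elim ∘ b≢w , id ]′ (v⇒z (inj₂ (v∈RG , matched-sym (adj G) (μ-perfect u∈RG) μu≡v)))

        w∈RG : w ∈ RG
        w∈RG = subst (_∈ RG) (proj₂ z-leaves-to-w) (Matched.partner∈ (μ-perfect (proj₁ z-leaves-to-w)))

        μw≡z : μ w ≡ z
        μw≡z = matched-sym (adj G) (μ-perfect (proj₁ z-leaves-to-w)) (proj₂ z-leaves-to-w)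

        u∈RH : u ∈ RH
        u∈RH = ∈-RH u∈X u∈RG (⊥-elim ∘ a≢u) (⊥-elim ∘ b≢w)

        w∈RH : w ∈ RH
        w∈RH = ∈-RH w∈X w∈RG (⊥-elim ∘ a≢u) (⊥-elim ∘ b≢w)

        uw⊆RH : ⁅ u ⁆ ∪ ⁅ w ⁆ ⊆ RH
        uw⊆RH {x} = [ (λ x∈u → subst (_∈ RH) (sym (∈-⁅⁆⁻ x∈u)) u∈RH)
                    , (λ x∈w → subst (_∈ RH) (sym (∈-⁅⁆⁻ x∈w)) w∈RH) ]′
                    ∘ ∈-∪⁻ ⁅ u ⁆ ⁅ w ⁆

        inside : ∀ {x} → x ∈ RH → x ∈ C → x ∈ RG × μ x ∈ RH × μ x ∈ C
        inside {x} x∈RH x∈C =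
          let x∈X , x∈RG , _ = ∈-RH⁻ x∈RH
              x∉u , x∉w = ∉-∪⁻ ⁅ u ⁆ ⁅ w ⁆ {x} (∈-∁⁻ (⁅ u ⁆ ∪ ⁅ w ⁆) {x} x∈C)
              μx-matched = μ-perfect x∈RG
              μx∈X : μ x ∈ X
              μx∈X = ¬-not λ μx∉X → [ ∉-⁅⁆⁻ x∉u ∘ proj₁ , ∉-⁅⁆⁻ x∉w ∘ proj₁ ]′ (crosses-at x∈X x∈RG μx∉X)
              μx≢ : ∀ {y y′} → μ y ≡ y′ → y′ ∉ X → μ x ≢ y
              μx≢ μy≡y′ y′∉X μx≡y = ∈∉⇒≢ x∈X y′∉X (trans (sym (matched-sym (adj G) μx-matched μx≡y)) μy≡y′)
          in x∈RG , ∈-RH μx∈X (Matched.partner∈ μx-matched) (⊥-elim ∘ a≢u) (⊥-elim ∘ b≢w)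
             , ∈-∁ (⁅ u ⁆ ∪ ⁅ w ⁆) {μ x} (∉-∪ ⁅ u ⁆ ⁅ w ⁆ {μ x} (∉-⁅⁆ (μx≢ μu≡v v∉X)) (∉-⁅⁆ (μx≢ μw≡z z∉X)))

        outside : ∀ {x} → x ∈ RH → x ∉ C → x ∈ ⁅ u ⁆ ∪ ⁅ w ⁆ × link u w id x ∈ RH × link u w id x ∉ C
        outside {x} x∈RH x∉C =
          let x∈uw = ∉-∁⁻ (⁅ u ⁆ ∪ ⁅ w ⁆) {x} x∉C
              partner∈uw = Matched.partner∈ (pair-perfectMatching {E = H} u≢w H-uw H-wu {x} x∈uw)
          in x∈uw , uw⊆RH partner∈uw , cong not partner∈uw

      matching : ∃ (IsPerfectMatching H RH)
      matching with a ≡? u | b ≡? w | true-or-false (RG u) | μ u ≡? v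
      ... | inj₂ a≢u | inj₂ b≢w | inj₁ u∈RG | inj₁ μu≡v = relink (a≢u , b≢w , u∈RG , μu≡v)
      ... | inj₁ a≡u | _        | _         | _         = μ , stay (λ (a≢u , _) → a≢u a≡u)
      ... | inj₂ _   | inj₁ b≡w | _         | _         = μ , stay (λ (_ , b≢w , _) → b≢w b≡w)
      ... | inj₂ _   | inj₂ _   | inj₂ u∉RG | _         = μ , stay (λ (_ , _ , u∈RG , _) → true≢false (trans (sym u∈RG) u∉RG))
      ... | inj₂ _   | inj₂ _   | inj₁ _    | inj₂ μu≢v = μ , stay (λ (_ , _ , _ , μu≡v) → μu≢v μu≡v)

    -- X is balanced, so a perfect matching of G uses both edges of the cut or neither.
    module CutParity {M} (M-perfect : IsPerfectMatching (adj G) (λ _ → true) M) where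

      private
        L : Fin (n G) → Bool
        L = leaving X (λ _ → true) M

        balance : count ((X ∩ ∁ col) ∩ L) ≡ count ((X ∩ col) ∩ L)
        balance = matching-balance {X} balanced M-perfect

        ∈-L : ∀ {x y} → M x ≡ y → y ∉ X → x ∈ L
        ∈-L Mx≡y y∉X = ∈-∁ (λ y → true ∧ X (M y)) (trans (cong X Mx≡y) y∉X)

        leaves-at : ∀ {x} → x ∈ X → x ∈ L → (x ≡ u × M x ≡ v) ⊎ (x ≡ w × M x ≡ z)
        leaves-at x∈X x∈L = crossing (Matched.edge (M-perfect refl)) x∈X (∈-∁⁻ (λ y → true ∧ X (M y)) x∈L)

      uses-uv⇒uses-wz : M u ≡ v → M w ≡ z
      uses-uv⇒uses-wz Mu≡v =
        let u∈ = cong₂ _∧_ (cong₂ _∧_ u∈X (∈-∁ col u∈A)) (∈-L Mu≡v v∉X)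
            x , x∈ = count-≡-nonempty {S = (X ∩ ∁ col) ∩ L} balance u∈
            x∈X∩B , x∈L = ∈-∩⁻ (X ∩ col) L x∈
            x∈X , x∈B = ∈-∩⁻ X col x∈X∩B
        in [ ⊥-elim ∘ colours-≢ u∈A x∈B ∘ sym ∘ proj₁ , (λ (x≡w , Mx≡z) → subst (λ y → M y ≡ z) x≡w Mx≡z) ]′
           (leaves-at x∈X x∈L)

      uses-wz⇒uses-uv : M w ≡ z → M u ≡ v
      uses-wz⇒uses-uv Mw≡z =
        let w∈ = cong₂ _∧_ (cong₂ _∧_ w∈X w∈B) (∈-L Mw≡z z∉X)
            x , x∈ = count-≡-nonempty {S = (X ∩ col) ∩ L} (sym balance) w∈
            x∈X∩A , x∈L = ∈-∩⁻ (X ∩ ∁ col) L x∈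
            x∈X , x∈A = ∈-∩⁻ X (∁ col) x∈X∩A
        in [ (λ (x≡u , Mx≡v) → subst (λ y → M y ≡ v) x≡u Mx≡v) , ⊥-elim ∘ colours-≢ (∈-∁⁻ col x∈A) w∈B ∘ proj₁ ]′
           (leaves-at x∈X x∈L)

    private
      w∈RG-if : a ≡ u → b ≢ w → w ∈ RG
      w∈RG-if a≡u b≢w = ∈-remaining (adj G) (λ _ → true) a b refl (colours-≢ a∈A w∈B ∘ sym) (b≢w ∘ sym)
        (subst (λ y → adj G w y ≡ false) (sym a≡u) (trans (Graph.sym G w u) uw∉E))
        (¬-not λ wb → bipartite w b wb (trans w∈B (sym b∈B)))

      u∈RG-if : b ≡ w → a ≢ u → u ∈ RG
      u∈RG-if b≡w a≢u = ∈-remaining (adj G) (λ _ → true) a b refl (a≢u ∘ sym) (colours-≢ u∈A b∈B)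
        (¬-not λ ua → bipartite u a ua (trans u∈A (sym a∈A)))
        (subst (λ y → adj G u y ≡ false) (sym b≡w) uw∉E)

      ∉X⇒∉RH : ∀ {x} → x ∉ X → x ∉ RH
      ∉X⇒∉RH x∉X = ¬-not λ x∈RH → true≢false (trans (sym (proj₁ (∈-RH⁻ x∈RH))) x∉X)

      enters-X-at : ∀ {M} → IsPerfectMatching (adj G) (λ _ → true) M → ∀ {x} → x ∉ X → M x ∈ X →
                    (M x ≡ u × x ≡ v) ⊎ (M x ≡ w × x ≡ z)
      enters-X-at {M} M-perfect {x} x∉X Mx∈X =
        crossing (trans (Graph.sym G (M x) x) (Matched.edge (M-perfect refl))) Mx∈X x∉X

    module Backward {ν} (ν-perfect : IsPerfectMatching H RH ν) where

      private
        combine : ∀ {P M} → IsPerfectMatching (adj G) P ν → IsPerfectMatching (adj G) (λ _ → true) M → P ⊆ RG →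
                  (∀ {x} → x ∈ RG → x ∉ P → M x ∈ RG × M x ∉ P) → ∃ (IsPerfectMatching (adj G) RG)
        combine {P} {M} ν-perfect′ M-perfect P⊆RG out =
          glue P ν M , perfectMatching-patch P ν-perfect′ M-perfect
            (λ {x} _ x∈P → let νx∈P = Matched.partner∈ (ν-perfect′ {x} x∈P) in x∈P , P⊆RG νx∈P , νx∈P)
            (λ {x} x∈RG x∉P → refl , out {x} x∈RG x∉P)

      through : (u ∈ RH → ν u ≡ w) → (w ∈ RH → ν w ≡ u) → (a ≢ u → u ∈ RG) → (b ≢ w → w ∈ RG) →
                ∃ (IsPerfectMatching (adj G) RG)
      through ν-u ν-w u∈RG′ w∈RG′ = combine ν-P M-perfect (RH⊆RG ∘ proj₁ ∘ ∈-∩⁻ RH C) out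
        where
        M-through : ∃ λ M → IsPerfectMatching (adj G) (λ _ → true) M × M u ≡ v
        M-through = perfectMatching-through 2 regular-bipartite {u} {v} refl refl edge-uv

        M : Fin (n G) → Fin (n G)
        M = proj₁ M-through

        M-perfect : IsPerfectMatching (adj G) (λ _ → true) M
        M-perfect = proj₁ (proj₂ M-through)

        Mu≡v : M u ≡ v
        Mu≡v = proj₂ (proj₂ M-through)

        Mw≡z : M w ≡ z
        Mw≡z = CutParity.uses-uv⇒uses-wz M-perfect Mu≡v

        C P : Fin (n G) → Bool
        C = ∁ (⁅ u ⁆ ∪ ⁅ w ⁆)
        P = RH ∩ C

        ∈P⁻ : ∀ {x} → x ∈ P → x ∈ RH × x ≢ u × x ≢ w
        ∈P⁻ {x} x∈P = let x∈RH , x∈C = ∈-∩⁻ RH C {x} x∈P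
                          x∉u , x∉w = ∉-∪⁻ ⁅ u ⁆ ⁅ w ⁆ {x} (∈-∁⁻ (⁅ u ⁆ ∪ ⁅ w ⁆) {x} x∈C)
                      in x∈RH , ∉-⁅⁆⁻ x∉u , ∉-⁅⁆⁻ x∉w

        ∉P⁻ : ∀ {x} → x ∉ P → x ∉ RH ⊎ x ∈ ⁅ u ⁆ ∪ ⁅ w ⁆
        ∉P⁻ {x} x∉P with true-or-false (RH x)
        ... | inj₂ x∉RH = inj₁ x∉RH
        ... | inj₁ x∈RH = inj₂ (∉-∁⁻ (⁅ u ⁆ ∪ ⁅ w ⁆) {x} (trans (cong (_∧ C x) (sym x∈RH)) x∉P))

        ∉X⇒∉P : ∀ {x} → x ∉ X → x ∉ P
        ∉X⇒∉P {x} x∉X = cong (_∧ C x) (∉X⇒∉RH x∉X)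

        uw∉P : ∀ {x} → x ∈ ⁅ u ⁆ ∪ ⁅ w ⁆ → x ∉ P
        uw∉P {x} x∈uw = trans (cong (λ c → RH x ∧ not c) x∈uw) (∧-zeroʳ (RH x))

        closed : ∀ {x} → x ∈ P → ν x ∈ P
        closed {x} x∈P =
          let x∈RH , x≢u , x≢w = ∈P⁻ x∈P
              x-matched = ν-perfect x∈RH
              partner≢ : ∀ {y y′} → (y ∈ RH → ν y ≡ y′) → x ≢ y′ → ν x ≢ y
              partner≢ ν-y x≢y′ νx≡y = x≢y′ (trans (sym (matched-sym H x-matched νx≡y))
                                                    (ν-y (subst (_∈ RH) νx≡y (Matched.partner∈ x-matched))))
          in cong₂ _∧_ (Matched.partner∈ x-matched)
               (∈-∁ (⁅ u ⁆ ∪ ⁅ w ⁆) {ν x}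
                 (∉-∪ ⁅ u ⁆ ⁅ w ⁆ {ν x} (∉-⁅⁆ (partner≢ ν-u x≢w)) (∉-⁅⁆ (partner≢ ν-w x≢u))))

        ν-P : IsPerfectMatching (adj G) P ν
        ν-P = perfectMatching-mono in-G (perfectMatching-restrict ν-perfect (proj₁ ∘ ∈P⁻) closed)
          where
          in-G : ∀ {x} → x ∈ P → H x (ν x) ≡ true → adj G x (ν x) ≡ true
          in-G x∈P Hxνx = let _ , x≢u , x≢w = ∈P⁻ x∈P in
            [ id , [ ⊥-elim ∘ x≢u ∘ proj₁ , ⊥-elim ∘ x≢w ∘ proj₁ ]′ ]′ (H-⊆ Hxνx)

        out : ∀ {x} → x ∈ RG → x ∉ P → M x ∈ RG × M x ∉ P
        out {x} x∈RG x∉P with true-or-false (X x)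
        ... | inj₁ x∈X = [ at-u , at-w ]′ x-is-u-or-w
          where
          x≢a : x ≢ a
          x≢a = proj₁ (proj₂ (∈-remaining⁻ (adj G) (λ _ → true) a b x∈RG))

          x≢b : x ≢ b
          x≢b = proj₁ (proj₂ (proj₂ (∈-remaining⁻ (adj G) (λ _ → true) a b x∈RG)))

          x-is-u-or-w : x ≡ u ⊎ x ≡ w
          x-is-u-or-w with ∉P⁻ x∉P
          ... | inj₁ x∉RH = [ inj₂ ∘ proj₂ , inj₁ ∘ proj₂ ]′ (∉RH-inside x∈X x∈RG x∉RH)
          ... | inj₂ x∈uw = [ inj₁ ∘ ∈-⁅⁆⁻ , inj₂ ∘ ∈-⁅⁆⁻ ]′ (∈-∪⁻ ⁅ u ⁆ ⁅ w ⁆ x∈uw)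

          at-u : x ≡ u → M x ∈ RG × M x ∉ P
          at-u refl = subst (_∈ RG) (sym Mu≡v)
                        (∈-RG-outside v∉X (λ a≡u → ⊥-elim (x≢a (sym a≡u))) (λ _ → colours-≢ z∈A v∈B ∘ sym))
                    , subst (_∉ P) (sym Mu≡v) (∉X⇒∉P v∉X)

          at-w : x ≡ w → M x ∈ RG × M x ∉ P
          at-w refl = subst (_∈ RG) (sym Mw≡z)
                        (∈-RG-outside z∉X (λ _ → colours-≢ z∈A v∈B) (λ b≡w → ⊥-elim (x≢b (sym b≡w))))
                    , subst (_∉ P) (sym Mw≡z) (∉X⇒∉P z∉X)
        ... | inj₂ x∉X with true-or-false (X (M x))
        ...   | inj₁ Mx∈X =
                [ (λ (Mx≡u , x≡v) → subst (_∈ RG) (sym Mx≡u) (u∈RG′ (λ a≡u → proj₁ (∈-RG⁻ x∈RG) a≡u x≡v))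
                                  , subst (_∉ P) (sym Mx≡u) (uw∉P (∈-∪ˡ ⁅ u ⁆ ⁅ w ⁆ (∈-⁅⁆ u))))
                , (λ (Mx≡w , x≡z) → subst (_∈ RG) (sym Mx≡w) (w∈RG′ (λ b≡w → proj₂ (∈-RG⁻ x∈RG) b≡w x≡z))
                                  , subst (_∉ P) (sym Mx≡w) (uw∉P (∈-∪ʳ ⁅ u ⁆ ⁅ w ⁆ (∈-⁅⁆ w)))) ]′
                (enters-X-at M-perfect x∉X Mx∈X)
        ...   | inj₂ Mx∉X = ∈-RG-outside Mx∉X (λ _ → returns Mu≡v u∈X) (λ _ → returns Mw≡z w∈X) , ∉X⇒∉P Mx∉X
          where
          returns : ∀ {y y′} → M y′ ≡ y → y′ ∈ X → M x ≢ y
          returns My′≡y y′∈X Mx≡y =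
            ∈∉⇒≢ y′∈X x∉X (trans (sym (matched-sym (adj G) (M-perfect refl) My′≡y))
                                 (matched-sym (adj G) (M-perfect refl) Mx≡y))

      avoid : a ≢ u → b ≢ w → ¬ (u ∈ RH × ν u ≡ w) → ∃ (IsPerfectMatching (adj G) RG)
      avoid a≢u b≢w no-uw = combine ν-G M-perfect RH⊆RG out
        where
        M-avoiding : ∃ λ M → IsPerfectMatching (adj G) (λ _ → true) M × M u ≢ v
        M-avoiding = perfectMatching-avoiding 1 regular-bipartite {u} v refl

        M : Fin (n G) → Fin (n G)
        M = proj₁ M-avoiding

        M-perfect : IsPerfectMatching (adj G) (λ _ → true) M
        M-perfect = proj₁ (proj₂ M-avoiding)

        Mu≢v : M u ≢ v
        Mu≢v = proj₂ (proj₂ M-avoiding)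

        ν-G : IsPerfectMatching (adj G) RH ν
        ν-G = perfectMatching-mono in-G ν-perfect
          where
          in-G : ∀ {x} → x ∈ RH → H x (ν x) ≡ true → adj G x (ν x) ≡ true
          in-G {x} x∈RH Hxνx =
            [ id
            , [ (λ (x≡u , νx≡w) → ⊥-elim (no-uw (subst (_∈ RH) x≡u x∈RH , subst (λ y → ν y ≡ w) x≡u νx≡w)))
              , (λ (x≡w , νx≡u) → ⊥-elim (no-uw (subst (_∈ RH) νx≡u (Matched.partner∈ (ν-perfect x∈RH))
                                               , trans (matched-sym H (ν-perfect x∈RH) νx≡u) x≡w))) ]′ ]′
            (H-⊆ Hxνx)

        out : ∀ {x} → x ∈ RG → x ∉ RH → M x ∈ RG × M x ∉ RH
        out {x} x∈RG x∉RH =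
          let x∉X : x ∉ X
              x∉X = ¬-not λ x∈X → [ a≢u ∘ proj₁ , b≢w ∘ proj₁ ]′ (∉RH-inside x∈X x∈RG x∉RH)
              M-back : ∀ {y y′} → M x ≡ y → x ≡ y′ → M y ≡ y′
              M-back Mx≡y x≡y′ = trans (matched-sym (adj G) (M-perfect refl) Mx≡y) x≡y′
              Mx∉X : M x ∉ X
              Mx∉X = ¬-not λ Mx∈X →
                [ (λ (Mx≡u , x≡v) → Mu≢v (M-back Mx≡u x≡v))
                , (λ (Mx≡w , x≡z) → Mu≢v (CutParity.uses-wz⇒uses-uv M-perfect (M-back Mx≡w x≡z))) ]′
                (enters-X-at M-perfect x∉X Mx∈X)
          in ∈-RG-outside Mx∉X (⊥-elim ∘ a≢u) (⊥-elim ∘ b≢w) , ∉X⇒∉RH Mx∉X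

      matching : ∃ (IsPerfectMatching (adj G) RG)
      matching with a ≡? u | b ≡? w
      ... | inj₁ a≡u | _ = through
              (λ u∈RH → ⊥-elim (proj₁ (proj₂ (∈-remaining⁻ H X a b u∈RH)) (sym a≡u)))
              (λ w∈RH → ⊥-elim (proj₁ (proj₂ (proj₂ (∈-RH⁻ w∈RH))) a≡u refl))
              (λ a≢u → ⊥-elim (a≢u a≡u)) (w∈RG-if a≡u)
      ... | inj₂ a≢u | inj₁ b≡w = through
              (λ u∈RH → ⊥-elim (proj₂ (proj₂ (proj₂ (∈-RH⁻ u∈RH))) b≡w refl))
              (λ w∈RH → ⊥-elim (proj₁ (proj₂ (proj₂ (∈-remaining⁻ H X a b w∈RH))) (sym b≡w)))
              (λ _ → u∈RG-if b≡w a≢u) (λ b≢w → ⊥-elim (b≢w b≡w))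
      ... | inj₂ a≢u | inj₂ b≢w with true-or-false (RH u) | ν u ≡? w
      ...   | inj₁ u∈RH | inj₁ νu≡w = through (λ _ → νu≡w) (λ _ → matched-sym H (ν-perfect u∈RH) νu≡w)
              (λ _ → RH⊆RG u∈RH) (λ _ → RH⊆RG (subst (_∈ RH) νu≡w (Matched.partner∈ (ν-perfect u∈RH))))
      ...   | inj₁ _    | inj₂ νu≢w = avoid a≢u b≢w (λ (_ , νu≡w) → νu≢w νu≡w)
      ...   | inj₂ u∉RH | _         = avoid a≢u b≢w (λ (u∈RH , _) → true≢false (trans (sym u∈RH) u∉RH))

    nicePair⇔ : NicePair G a b ⇔ NicePairSubPlus G X u w a b
    nicePair⇔ = mk⇔
      (λ nice → toHasPerfectMatching (Forward.matching (proj₂ (fromHasPerfectMatching {E = adj G} nice))))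
      (λ nice → toHasPerfectMatching (Backward.matching (proj₂ (fromHasPerfectMatching {E = H} nice))))

  no-nicePair-across : ∀ {X u v w z} → TwoCut G X u v w z →
                       ∀ {a b} → col a ≡ false → a ∈ X → b ∉ X → ¬ NicePair G a b
  no-nicePair-across {u = u} {w = w} cut a∈A a∈X b∉X with col u in u-colour
  ... | false = no-nicePair-across-oriented cut u-colour a∈A a∈X b∉X
  ... | true  = no-nicePair-across-oriented (swapCut cut) (Cut.other-end-colour cut u-colour) a∈A a∈X b∉X

  nicePair⇔nicePair-plus : ∀ {X u v w z} → TwoCut G X u v w z → adj G u w ≡ false →
    ∀ {a b} → col a ≡ false → col b ≡ true → a ∈ X → b ∈ X → NicePair G a b ⇔ NicePairSubPlus G X u w a b
  nicePair⇔nicePair-plus {X} {u} {w = w} cut uw∉E a∈A b∈B a∈X b∈X with col u in u-colour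
  ... | false = Reduction.nicePair⇔ cut u-colour uw∉E a∈A b∈B a∈X b∈X
  ... | true  = mk⇔ (nicePairIn-cong {S = X} swap-ends ∘ to)
                    (from ∘ nicePairIn-cong {S = X} (λ x y → sym (swap-ends x y)))
    where
    open Equivalence (Reduction.nicePair⇔ (swapCut cut) (Cut.other-end-colour cut u-colour)
                                          (trans (Graph.sym G w u) uw∉E) a∈A b∈B a∈X b∈X)

    swap-ends : ∀ x y → adjPlus G w u x y ≡ adjPlus G u w x y
    swap-ends x y = cong (adj G x y ∨_) (∨-comm (⌊ x ≟ w ⌋ ∧ ⌊ y ≟ u ⌋) (⌊ x ≟ u ⌋ ∧ ⌊ y ≟ w ⌋))

lemma4p7 : (G : Graph) → Connected G → Cubic G →
    (col : Fin (n G) → Bool) → IsBipartition G col →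
    (X : Fin (n G) → Bool) → (u v w z : Fin (n G)) →
    IsTwoCut G X u v w z → adj G u w ≡ false →
    (a b : Fin (n G)) → col a ≡ false → col b ≡ true →
    (NicePair G a b →
      ((X a ≡ true × X b ≡ true) ⊎ (X a ≡ false × X b ≡ false)))
    × (X a ≡ true → X b ≡ true →
      (NicePair G a b ⇔ NicePairSubPlus G X u w a b))
lemma4p7 G _ cubic col bipartite X u v w z two-cut uw∉E a b a∈A b∈B =
  same-side , nicePair⇔nicePair-plus cut uw∉E a∈A b∈B
  where
  open CubicBipartite G cubic col bipartite

  cut : TwoCut G X u v w z
  cut = fromIsTwoCut two-cut

  same-side : NicePair G a b → (X a ≡ true × X b ≡ true) ⊎ (X a ≡ false × X b ≡ false)
  same-side nice with X a in a-side | X b in b-side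
  ... | true  | true  = inj₁ (refl , refl)
  ... | false | false = inj₂ (refl , refl)
  ... | true  | false = ⊥-elim (no-nicePair-across cut a∈A a-side b-side nice)
  ... | false | true  =
    ⊥-elim (no-nicePair-across (complementCut cut) a∈A (cong not a-side) (cong not b-side) nice)
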